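{- Let $G$ be a bipartite graph and let $v$ be a vertex in $G$. If $G$ is the edge-disjoint union of an induced cycle $C$ through $v$ and a path $P$ starting at $v$, then $\chi'_{\rm irr}(G)\leq 4$.
   Context: All graphs are finite and simple. A graph is locally irregular if any two adjacent vertices have distinct degrees. $\chi'_{\rm irr}(G)$ is the least number of colours in an edge-colouring of $G$ in which, for each colour, the subgraph formed by the edges of that colour is locally irregular. -}

module Defs where

open import Data.Nat using (ℕ; zero; suc; _≤_)
open import Data.Fin using (Fin; toℕ; zero; _≟_)
open import Data.Bool using (Bool; true; false; _∧_; if_then_else_)
open import Data.List using (List; map; allFin)
open import Data.Nat.ListAction using (sum)
open import Data.Product using (Σ; ∃; ∃-syntax; _×_; _,_)
open import Data.Sum using (_⊎_)
open import Relation.Nullary using (¬_)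
open import Relation.Nullary.Decidable using (⌊_⌋)
open import Relation.Binary.PropositionalEquality using (_≡_; _≢_)
open import Function.Definitions using (Injective)

record Graph (n : ℕ) : Set where
  field
    adj     : Fin n → Fin n → Bool
    sym     : ∀ u w → adj u w ≡ adj w u
    irrefl  : ∀ u → adj u u ≡ false
open Graph public

deg : {n : ℕ} → (Fin n → Fin n → Bool) → Fin n → ℕ
deg {n} a u = sum (map (λ w → if a u w then 1 else 0) (allFin n))

LocallyIrregular : {n : ℕ} → (Fin n → Fin n → Bool) → Set
LocallyIrregular a = ∀ u w → a u w ≡ true → deg a u ≢ deg a w

-- An edge-colouring with k colours: a colour assigned to each edge
-- (the value on non-adjacent pairs is irrelevant), symmetric on edges.
record EdgeColouring {n : ℕ} (G : Graph n) (k : ℕ) : Set where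
  field
    col    : Fin n → Fin n → Fin k
    col-sym : ∀ u w → adj G u w ≡ true → col u w ≡ col w u
open EdgeColouring public

colourClass : {n k : ℕ} {G : Graph n} → EdgeColouring G k → Fin k → Fin n → Fin n → Bool
colourClass {G = G} c i u w = adj G u w ∧ ⌊ col c u w ≟ i ⌋

IsLocIrrColouring : {n k : ℕ} {G : Graph n} → EdgeColouring G k → Set
IsLocIrrColouring c = ∀ i → LocallyIrregular (colourClass c i)

χ'irr≤ : {n : ℕ} → Graph n → ℕ → Set
χ'irr≤ G k = Σ (EdgeColouring G k) IsLocIrrColouring

Bipartite : {n : ℕ} → Graph n → Set
Bipartite {n} G = Σ (Fin n → Bool) λ side → ∀ u w → adj G u w ≡ true → side u ≢ side w

CycNext : (m : ℕ) → Fin m → Fin m → Set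
CycNext m i j = (suc (toℕ i) ≡ toℕ j) ⊎ (suc (toℕ i) ≡ m × toℕ j ≡ 0)

PathNext : {m : ℕ} → Fin m → Fin m → Set
PathNext i j = suc (toℕ i) ≡ toℕ j

CycleEdge : {n m : ℕ} → (Fin m → Fin n) → Fin n → Fin n → Set
CycleEdge {m = m} cyc u w = ∃[ i ] ∃[ j ] (CycNext m i j ×
  ((u ≡ cyc i × w ≡ cyc j) ⊎ (u ≡ cyc j × w ≡ cyc i)))

PathEdge : {n m : ℕ} → (Fin m → Fin n) → Fin n → Fin n → Set
PathEdge pth u w = ∃[ i ] ∃[ j ] (PathNext i j ×
  ((u ≡ pth i × w ≡ pth j) ⊎ (u ≡ pth j × w ≡ pth i)))

-- C has m ≥ 3 distinct vertices cyc 0 = v, cyc 1, …, cyc (m-1);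
-- P has l+1 distinct vertices pth 0 = v, …, pth l (length l ≥ 0).
record CyclePathDecomp {n : ℕ} (G : Graph n) (v : Fin n) : Set where
  field
    m        : ℕ
    m≥3      : 3 ≤ m
    cyc      : Fin m → Fin n
    cyc-inj  : Injective _≡_ _≡_ cyc
    cyc-v    : ∀ (i : Fin m) → toℕ i ≡ 0 → cyc i ≡ v
    l        : ℕ
    pth      : Fin (suc l) → Fin n
    pth-inj  : Injective _≡_ _≡_ pth
    pth-v    : pth zero ≡ v
    edges    : ∀ u w → adj G u w ≡ true → CycleEdge cyc u w ⊎ PathEdge pth u w
    cyc-sub  : ∀ u w → CycleEdge cyc u w → adj G u w ≡ true
    pth-sub  : ∀ u w → PathEdge pth u w → adj G u w ≡ true
    disjoint : ∀ u w → CycleEdge cyc u w → ¬ PathEdge pth u w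
    induced  : ∀ i j → adj G (cyc i) (cyc j) ≡ true → CycleEdge cyc (cyc i) (cyc j)
    vertices : ∀ u → (∃[ i ] cyc i ≡ u) ⊎ (∃[ j ] pth j ≡ u)

module Submission where

-- Colours 0 and 1 (the palette X) go to the cycle and to at most the first two
-- path edges, colours 2 and 3 (the palette Y) to the rest of the path.  Edges
-- are coloured in consecutive pairs, the pair containing edge j getting the
-- parity of ⌊ j / 2 ⌋, so a colour class is mostly a union of paths of length
-- two.  Bipartiteness makes m even; the pairs close up around the cycle when
-- m ≡ 0 (mod 4).  Otherwise the parity defect is absorbed at hubs: vertices
-- whose two cycle edges and a pendant path edge share a colour, giving degree
-- 3 against neighbours of degree at most 2.  The hub is v, plus pth 2 when the
-- X-coloured start of the path must reach pth 2 and pth 2 lies on the cycle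
-- (at an even index, again by bipartiteness).  The Y-coloured rest of the path
-- is chosen of even length, so it splits into pairs; without a path, the last
-- two cycle edges take a third colour instead.

open import Defs hiding (sym)
open import Data.Nat using (ℕ; zero; suc; pred; ≢-nonZero; parity; ⌊_/2⌋; _∸_; _+_; _*_; _<_; _≤_; z≤n; s≤s; _<?_; _≤?_)
import Data.Nat as ℕ
open import Data.Nat.Properties
  using (+-0-commutativeMonoid; *-distribʳ-+; +-identityʳ; ≤-trans; <-irrefl; ≤-antisym; ≮⇒≥; n≤1+n; suc-injective; 1+n≢0;
         m≢1+m+n; +-comm; ≤-reflexive; <⇒≤; ≤-pred; m≤m+n; m+n∸m≡n; m+[n∸m]≡n; +-suc; ≤∧≢⇒<; ≤-refl; ≰⇒>;
         n<1⇒n≡0; suc-pred; 1+n≢n)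
open import Data.Parity.Base using (Parity; 0ℙ; 1ℙ; _⁻¹)
import Data.Parity.Base as ℙ
open import Data.Parity.Properties using (suc-homo-⁻¹; ⁻¹-involutive)
import Data.Parity.Properties as ℙ
open import Data.Fin using (Fin; toℕ; fromℕ<; _≟_; inject₁) renaming (zero to 0F; suc to sucF)
open import Data.Fin.Properties using (toℕ-injective; toℕ<n; toℕ-fromℕ<; any?; toℕ-inject₁; fromℕ<-toℕ)
open import Data.Bool using (Bool; true; false; if_then_else_; not; _∧_)
open import Data.Bool.Properties using (not-involutive; not-¬; ¬-not)
open import Data.List using (List; []; _∷_; _++_; map; allFin; tabulate)
open import Data.List.Properties using (map-tabulate; map-++)
open import Data.Nat.ListAction using () renaming (sum to listSum)
open import Data.Nat.ListAction.Properties using (sum-++)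
open import Data.Maybe using (Maybe; just; nothing; maybe)
open import Data.Product using (_×_; _,_; proj₁; proj₂)
open import Data.Sum using (_⊎_; inj₁; inj₂)
open import Data.Empty using (⊥; ⊥-elim)
open import Relation.Nullary using (yes; no; does; ¬_; contradiction)
open import Relation.Nullary.Decidable using (⌊_⌋; _⊎-dec_; _×-dec_)
open import Relation.Binary.Definitions using (Decidable)
open import Relation.Binary.PropositionalEquality
open import Function using (_∘_)
open import Function.Definitions using (Injective)
open import Algebra.Properties.CommutativeMonoid.Sum +-0-commutativeMonoid
  using (sum; sum-syntax; ∑-distrib-+; sum-cong-≗; sum-replicate-zero)

-- Degrees read off neighbour lists

δ : ∀ {k} → Fin k → Fin k → ℕ
δ x w = if does (x ≟ w) then 1 else 0

δ-refl : ∀ {k} (x : Fin k) → δ x x ≡ 1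
δ-refl x with x ≟ x
... | yes _ = refl
... | no x≢x = contradiction refl x≢x

δ-≢ : ∀ {k} {x w : Fin k} → x ≢ w → δ x w ≡ 0
δ-≢ {x = x} {w} x≢w with x ≟ w
... | yes x≡w = contradiction x≡w x≢w
... | no _    = refl

δ≤1 : ∀ {k} (x w : Fin k) → δ x w ≤ 1
δ≤1 x w with x ≟ w
... | yes _ = s≤s z≤n
... | no _  = z≤n

listSum-tabulate : ∀ {n} (g : Fin n → ℕ) → listSum (tabulate g) ≡ sum g
listSum-tabulate {zero}  g = refl
listSum-tabulate {suc n} g = cong (g 0F +_) (listSum-tabulate (g ∘ sucF))

listSum-allFin : ∀ {n} (g : Fin n → ℕ) → listSum (map g (allFin n)) ≡ sum g
listSum-allFin {n} g = trans (cong listSum (map-tabulate {n = n} (λ w → w) g)) (listSum-tabulate g)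

∑-δ : ∀ {n} (x : Fin n) (g : Fin n → ℕ) → ∑[ w < n ] (δ x w * g w) ≡ g x
∑-δ {suc n} 0F       g = trans (cong₂ _+_ (+-identityʳ (g 0F)) (sum-replicate-zero n)) (+-identityʳ (g 0F))
∑-δ {suc n} (sucF x) g = ∑-δ {n} x (g ∘ sucF)

multiplicity : ∀ {n} → List (Fin n) → Fin n → ℕ
multiplicity xs w = listSum (map (λ x → δ x w) xs)

∑-multiplicity : ∀ {n} (xs : List (Fin n)) (g : Fin n → ℕ) →
  ∑[ w < n ] (multiplicity xs w * g w) ≡ listSum (map g xs)
∑-multiplicity {n} []       g = sum-replicate-zero n
∑-multiplicity {n} (x ∷ xs) g = begin
  ∑[ w < n ] ((δ x w + multiplicity xs w) * g w)         ≡⟨ sum-cong-≗ (λ w → *-distribʳ-+ (g w) (δ x w) _) ⟩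
  ∑[ w < n ] (δ x w * g w + multiplicity xs w * g w)     ≡⟨ ∑-distrib-+ (λ w → δ x w * g w) _ ⟩
  ∑[ w < n ] (δ x w * g w) + ∑[ w < n ] (multiplicity xs w * g w) ≡⟨ cong₂ _+_ (∑-δ x g) (∑-multiplicity xs g) ⟩
  g x + listSum (map g xs)                               ∎
  where open ≡-Reasoning

multiplicity-++ : ∀ {n} (xs ys : List (Fin n)) w → multiplicity (xs ++ ys) w ≡ multiplicity xs w + multiplicity ys w
multiplicity-++ xs ys w = trans (cong listSum (map-++ (λ x → δ x w) xs ys)) (sum-++ (map (λ x → δ x w) xs) _)

degree-by-neighbours : ∀ {n k} {G : Graph n} (c : EdgeColouring G k) (i : Fin k) (u : Fin n) (N : List (Fin n)) →
  (∀ w → multiplicity N w ≡ (if adj G u w then 1 else 0)) →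
  deg (colourClass c i) u ≡ listSum (map (λ w → δ (col c u w) i) N)
degree-by-neighbours {n} {G = G} c i u N N-enumerates =
  trans (listSum-allFin {n} (λ w → if colourClass c i u w then 1 else 0))
        (trans (sum-cong-≗ pointwise) (∑-multiplicity N (λ w → δ (col c u w) i)))
  where
  pointwise : ∀ w → (if adj G u w ∧ ⌊ col c u w ≟ i ⌋ then 1 else 0) ≡ multiplicity N w * δ (col c u w) i
  pointwise w rewrite N-enumerates w with adj G u w | col c u w ≟ i
  ... | true  | yes _ = refl
  ... | true  | no _  = refl
  ... | false | _     = refl

-- Pair patterns and the two palettes

parity-suc : ∀ j → parity (suc j) ≡ parity j ⁻¹
parity-suc j = trans (sym (⁻¹-involutive (parity (suc j)))) (cong _⁻¹ (suc-homo-⁻¹ j))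

⁻¹-distribˡ-+ : ∀ p q → (p ℙ.+ q) ⁻¹ ≡ p ⁻¹ ℙ.+ q
⁻¹-distribˡ-+ 0ℙ q = refl
⁻¹-distribˡ-+ 1ℙ q = ⁻¹-involutive q

even-nonzero⇒2≤ : ∀ {k} → k ≢ 0 → parity k ≡ 0ℙ → 2 ≤ k
even-nonzero⇒2≤ {0}           k≢0 _ = ⊥-elim (k≢0 refl)
even-nonzero⇒2≤ {1}           _   ()
even-nonzero⇒2≤ {suc (suc _)} _   _ = s≤s (s≤s z≤n)

pairParity : ℕ → Parity
pairParity j = parity ⌊ j /2⌋

pairParity-+2 : ∀ j → pairParity (suc (suc j)) ≡ pairParity j ⁻¹
pairParity-+2 j = parity-suc ⌊ j /2⌋

pairParity-suc : ∀ j → pairParity (suc j) ≡ pairParity j ℙ.+ parity j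
pairParity-suc zero          = refl
pairParity-suc (suc zero)    = refl
pairParity-suc (suc (suc j)) = begin
  pairParity (3 + j)                     ≡⟨ pairParity-+2 (suc j) ⟩
  pairParity (suc j) ⁻¹                  ≡⟨ cong _⁻¹ (pairParity-suc j) ⟩
  (pairParity j ℙ.+ parity j) ⁻¹         ≡⟨ ⁻¹-distribˡ-+ (pairParity j) (parity j) ⟩
  pairParity j ⁻¹ ℙ.+ parity j           ≡⟨ sym (cong (ℙ._+ parity j) (pairParity-+2 j)) ⟩
  pairParity (2 + j) ℙ.+ parity (2 + j)  ∎
  where open ≡-Reasoning

pairParity-even : ∀ {j} → parity j ≡ 0ℙ → pairParity (suc j) ≡ pairParity j
pairParity-even {j} even = trans (pairParity-suc j) (trans (cong (pairParity j ℙ.+_) even) (ℙ.+-identityʳ _))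

pairParity-odd : ∀ {j} → parity j ≡ 1ℙ → pairParity (suc j) ≡ pairParity j ⁻¹
pairParity-odd {j} odd = trans (pairParity-suc j) (trans (cong (pairParity j ℙ.+_) odd) (ℙ.+-comm (pairParity j) 1ℙ))

pairParity-before-even : ∀ {j} → parity (suc j) ≡ 0ℙ → pairParity j ≡ pairParity (suc j) ⁻¹
pairParity-before-even {j} even = trans (sym (⁻¹-involutive (pairParity j))) (cong _⁻¹ (sym (pairParity-odd {j} j-odd)))
  where
  j-odd : parity j ≡ 1ℙ
  j-odd = ℙ.⁻¹-injective (trans (sym (parity-suc j)) even)

X Y : Parity → Fin 4
X 0ℙ = 0F
X 1ℙ = sucF 0F
Y 0ℙ = sucF (sucF 0F)
Y 1ℙ = sucF (sucF (sucF 0F))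

X-⁻¹ : ∀ a → X a ≢ X (a ⁻¹)
X-⁻¹ 0ℙ ()
X-⁻¹ 1ℙ ()

δ-XY : ∀ p q → δ (X p) (Y q) ≡ 0
δ-XY 0ℙ 0ℙ = refl
δ-XY 0ℙ 1ℙ = refl
δ-XY 1ℙ 0ℙ = refl
δ-XY 1ℙ 1ℙ = refl

δ-YX : ∀ p q → δ (Y q) (X p) ≡ 0
δ-YX 0ℙ 0ℙ = refl
δ-YX 0ℙ 1ℙ = refl
δ-YX 1ℙ 0ℙ = refl
δ-YX 1ℙ 1ℙ = refl

δ-⁻¹ : ∀ (f : Parity → Fin 4) → f 0ℙ ≢ f 1ℙ → ∀ a b → δ (f a) (f b) + δ (f (a ⁻¹)) (f b) ≡ 1
δ-⁻¹ f f-inj 0ℙ 0ℙ = cong₂ _+_ (δ-refl (f 0ℙ)) (δ-≢ (λ e → f-inj (sym e)))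
δ-⁻¹ f f-inj 0ℙ 1ℙ = cong₂ _+_ (δ-≢ f-inj) (δ-refl (f 1ℙ))
δ-⁻¹ f f-inj 1ℙ 0ℙ = cong₂ _+_ (δ-≢ (λ e → f-inj (sym e))) (δ-refl (f 0ℙ))
δ-⁻¹ f f-inj 1ℙ 1ℙ = cong₂ _+_ (δ-refl (f 1ℙ)) (δ-≢ f-inj)

δ-⁻¹-distinct : ∀ (f : Parity → Fin 4) → f 0ℙ ≢ f 1ℙ → ∀ a b → suc (δ (f a) (f b)) ≢ δ (f (a ⁻¹)) (f b) + 1
δ-⁻¹-distinct f f-inj a b = sum-one-distinct (δ-⁻¹ f f-inj a b)
  where
  sum-one-distinct : ∀ {A B} → A + B ≡ 1 → suc A ≢ B + 1
  sum-one-distinct {zero}            refl ()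
  sum-one-distinct {suc zero} {zero} refl ()
  sum-one-distinct {suc zero} {suc _} ()
  sum-one-distinct {suc (suc _)}      ()

-- Vertex sequences

module Locate {n k : ℕ} (f : Fin k → Fin n) (f-injective : Injective _≡_ _≡_ f) where

  index : Fin n → Maybe (Fin k)
  index u with any? (λ i → f i ≟ u)
  ... | yes (i , _) = just i
  ... | no _        = nothing

  data IndexView (u : Fin n) : Maybe (Fin k) → Set where
    found  : ∀ i → f i ≡ u → IndexView u (just i)
    absent : (∀ i → f i ≢ u) → IndexView u nothing

  index-view : ∀ u → IndexView u (index u)
  index-view u with any? (λ i → f i ≟ u)
  ... | yes (i , fi≡u) = found i fi≡u
  ... | no ∄i          = absent (λ i fi≡u → ∄i (i , fi≡u))

  index-image : ∀ i → index (f i) ≡ just i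
  index-image i with any? (λ j → f j ≟ f i)
  ... | yes (j , fj≡fi) = cong just (f-injective fj≡fi)
  ... | no ∄j           = ⊥-elim (∄j (i , refl))

module Oriented {I : Set} (Step : I → I → Set) (step? : Decidable Step)
                (step-asym : ∀ {i j} → Step i j → ¬ Step j i) (κ : I → Fin 4) where

  orientedColour : I → I → Fin 4 → Fin 4
  orientedColour i j d with step? i j | step? j i
  ... | yes _ | _     = κ i
  ... | no _  | yes _ = κ j
  ... | no _  | no _  = d

  orientedColour-sym : ∀ i j d → orientedColour i j d ≡ orientedColour j i d
  orientedColour-sym i j d with step? i j | step? j i
  ... | yes s | yes s′ = ⊥-elim (step-asym s s′)
  ... | yes _ | no _   = refl
  ... | no _  | yes _  = refl
  ... | no _  | no _   = refl

  orientedColour-step : ∀ {i j} d → Step i j → orientedColour i j d ≡ κ i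
  orientedColour-step {i} {j} d s with step? i j
  ... | yes _ = refl
  ... | no ¬s = ⊥-elim (¬s s)

  orientedColour-nonStep : ∀ {i j} d → ¬ Step i j → ¬ Step j i → orientedColour i j d ≡ d
  orientedColour-nonStep {i} {j} d ¬s ¬s′ with step? i j | step? j i
  ... | yes s | _     = ⊥-elim (¬s s)
  ... | no _  | yes s = ⊥-elim (¬s′ s)
  ... | no _  | no _  = refl

module CyclePath {n : ℕ} {G : Graph n} {v : Fin n} (D : CyclePathDecomp G v) where
  open CyclePathDecomp D

  0<m : 0 < m
  0<m = ≤-trans (s≤s z≤n) m≥3

  suc-pred-m : suc (pred m) ≡ m
  suc-pred-m = go m≥3
    where
    go : ∀ {k} → 3 ≤ k → suc (pred k) ≡ k
    go (s≤s _) = refl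

  -- Cycle edge x joins cyc x and cyc (next x); indices are naturals below m.
  next : ℕ → ℕ
  next x with suc x <? m
  ... | yes _ = suc x
  ... | no _  = 0

  prev : ℕ → ℕ
  prev zero    = pred m
  prev (suc x) = x

  next-< : ∀ {x} → suc x < m → next x ≡ suc x
  next-< {x} x+1<m with suc x <? m
  ... | yes _     = refl
  ... | no x+1≮m = ⊥-elim (x+1≮m x+1<m)

  next-last : ∀ {x} → suc x ≡ m → next x ≡ 0
  next-last {x} x+1≡m with suc x <? m
  ... | yes x+1<m = ⊥-elim (<-irrefl x+1≡m x+1<m)
  ... | no _      = refl

  data NextView (x : ℕ) : ℕ → Set where
    step : suc x < m → NextView x (suc x)
    wrap : suc x ≡ m → NextView x 0

  next-view : ∀ {x} → x < m → NextView x (next x)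
  next-view {x} x<m with suc x <? m
  ... | yes x+1<m = step x+1<m
  ... | no x+1≮m  = wrap (≤-antisym x<m (≮⇒≥ x+1≮m))

  next<m : ∀ {x} → x < m → next x < m
  next<m {x} x<m with next x | next-view x<m
  ... | _ | step x+1<m = x+1<m
  ... | _ | wrap _     = 0<m

  prev<m : ∀ {x} → x < m → prev x < m
  prev<m {zero}  _      = ≤-reflexive suc-pred-m
  prev<m {suc x} x+1<m = <⇒≤ x+1<m

  prev-next : ∀ {x} → x < m → prev (next x) ≡ x
  prev-next {x} x<m with next x | next-view x<m
  ... | _ | step _     = refl
  ... | _ | wrap x+1≡m = suc-injective (trans suc-pred-m (sym x+1≡m))

  data CyclePosition : ℕ → Set where
    first  : CyclePosition 0
    last   : ∀ {x} → suc (suc x) ≡ m → CyclePosition (suc x)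
    middle : ∀ {x} → suc (suc x) < m → CyclePosition (suc x)

  cyclePosition : ∀ {x} → x < m → CyclePosition x
  cyclePosition {zero}  _ = first
  cyclePosition {suc x} x+1<m with suc (suc x) ℕ.≟ m
  ... | yes x+2≡m = last x+2≡m
  ... | no x+2≢m  = middle (≤∧≢⇒< x+1<m x+2≢m)

  next-0 : next 0 ≡ 1
  next-0 = next-< (≤-trans (s≤s (s≤s z≤n)) m≥3)

  nextᶠ prevᶠ : Fin m → Fin m
  nextᶠ i = fromℕ< (next<m (toℕ<n i))
  prevᶠ i = fromℕ< (prev<m (toℕ<n i))

  toℕ-nextᶠ : ∀ i → toℕ (nextᶠ i) ≡ next (toℕ i)
  toℕ-nextᶠ i = toℕ-fromℕ< _

  toℕ-prevᶠ : ∀ i → toℕ (prevᶠ i) ≡ prev (toℕ i)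
  toℕ-prevᶠ i = toℕ-fromℕ< _

  cycNext-next : ∀ {i j} → toℕ j ≡ next (toℕ i) → CycNext m i j
  cycNext-next {i} j≡ with next (toℕ i) | next-view (toℕ<n i)
  ... | _ | step _     = inj₁ (sym j≡)
  ... | _ | wrap i+1≡m = inj₂ (i+1≡m , j≡)

  cycNext-nextᶠ : ∀ i → CycNext m i (nextᶠ i)
  cycNext-nextᶠ i = cycNext-next (toℕ-nextᶠ i)

  cycNext-prevᶠ : ∀ j → CycNext m (prevᶠ j) j
  cycNext-prevᶠ j = go (toℕ j) refl
    where
    go : ∀ x → toℕ j ≡ x → CycNext m (prevᶠ j) j
    go zero    j≡0 = inj₂ (trans (cong suc (trans (toℕ-prevᶠ j) (cong prev j≡0))) suc-pred-m , j≡0)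
    go (suc x) j≡  = inj₁ (trans (cong suc (trans (toℕ-prevᶠ j) (cong prev j≡))) (sym j≡))

  cycNext-functional : ∀ {i j j′} → CycNext m i j → CycNext m i j′ → j ≡ j′
  cycNext-functional (inj₁ p) (inj₁ q) = toℕ-injective (trans (sym p) q)
  cycNext-functional {j = j} (inj₁ p) (inj₂ (q , _)) = ⊥-elim (<-irrefl (trans (sym p) q) (toℕ<n j))
  cycNext-functional {j′ = j′} (inj₂ (p , _)) (inj₁ q) = ⊥-elim (<-irrefl (trans (sym q) p) (toℕ<n j′))
  cycNext-functional (inj₂ (_ , p)) (inj₂ (_ , q)) = toℕ-injective (trans p (sym q))

  cycNext-injective : ∀ {i i′ j} → CycNext m i j → CycNext m i′ j → i ≡ i′
  cycNext-injective (inj₁ p) (inj₁ q) = toℕ-injective (suc-injective (trans p (sym q)))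
  cycNext-injective (inj₁ p) (inj₂ (_ , q)) = ⊥-elim (1+n≢0 (trans p q))
  cycNext-injective (inj₂ (_ , p)) (inj₁ q) = ⊥-elim (1+n≢0 (trans q p))
  cycNext-injective (inj₂ (p , _)) (inj₂ (q , _)) = toℕ-injective (suc-injective (trans p (sym q)))

  cycNext-asym : ∀ {i j} → CycNext m i j → ¬ CycNext m j i
  cycNext-asym {i} (inj₁ p) (inj₁ q) = m≢1+m+n (toℕ i) {1} (trans (sym q) (cong suc (trans (sym p) (+-comm 1 (toℕ i)))))
  cycNext-asym (inj₁ p) (inj₂ (q , r)) = <-irrefl (sym (trans (sym q) (cong suc (trans (sym p) (cong suc r))))) m≥3
  cycNext-asym (inj₂ (p , r)) (inj₁ q) = <-irrefl (sym (trans (sym p) (cong suc (trans (sym q) (cong suc r))))) m≥3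
  cycNext-asym (inj₂ (_ , r)) (inj₂ (q , _)) = <-irrefl (sym (trans (sym q) (cong suc r))) (≤-trans (s≤s (s≤s z≤n)) m≥3)

  open Locate cyc cyc-inj public
    renaming (index to cycleIndex; IndexView to CycleView; found to onCycle; absent to offCycle;
              index-view to cycleIndex-view; index-image to cycleIndex-cyc)
  open Locate pth pth-inj public
    renaming (index to pathIndex; IndexView to PathView; found to onPath; absent to offPath;
              index-view to pathIndex-view; index-image to pathIndex-pth)

  pathNext-asym : ∀ {y z : Fin (suc l)} → PathNext y z → ¬ PathNext z y
  pathNext-asym {y} y→z z→y = m≢1+m+n (toℕ y) {1} (trans (sym z→y) (cong suc (trans (sym y→z) (+-comm 1 (toℕ y)))))

  v-on-cycle : cyc (fromℕ< 0<m) ≡ v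
  v-on-cycle = cyc-v _ (toℕ-fromℕ< 0<m)

  consecutive-offCycle : ∀ {y z i j} → PathNext y z → pth y ≡ cyc i → pth z ≢ cyc j
  consecutive-offCycle {y} {z} {i} {j} y→z y≡i z≡j =
    disjoint (cyc i) (cyc j) (induced i j (pth-sub _ _ path-edge)) path-edge
    where
    path-edge : PathEdge pth (cyc i) (cyc j)
    path-edge = y , z , y→z , inj₁ (sym y≡i , sym z≡j)

  pth₁-offCycle : ∀ {y} → toℕ y ≡ 1 → ∀ i → cyc i ≢ pth y
  pth₁-offCycle {y} y≡1 i i≡y =
    consecutive-offCycle {y = 0F} (sym y≡1) (trans pth-v (sym v-on-cycle)) (sym i≡y)

  cycleNeighbours : Maybe (Fin m) → List (Fin n)
  cycleNeighbours nothing  = []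
  cycleNeighbours (just i) = cyc (nextᶠ i) ∷ cyc (prevᶠ i) ∷ []

  forwardNeighbours : Fin (suc l) → List (Fin n)
  forwardNeighbours y with toℕ y <? l
  ... | yes y<l = pth (fromℕ< (s≤s y<l)) ∷ []
  ... | no _    = []

  backwardNeighbours : Fin (suc l) → List (Fin n)
  backwardNeighbours 0F       = []
  backwardNeighbours (sucF y) = pth (inject₁ y) ∷ []

  pathNeighbours : Maybe (Fin (suc l)) → List (Fin n)
  pathNeighbours nothing  = []
  pathNeighbours (just y) = forwardNeighbours y ++ backwardNeighbours y

  neighbours : Fin n → List (Fin n)
  neighbours u = cycleNeighbours (cycleIndex u) ++ pathNeighbours (pathIndex u)

  multiplicity-cycleNeighbours-edge : ∀ {u w} → CycleEdge cyc u w → multiplicity (cycleNeighbours (cycleIndex u)) w ≡ 1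
  multiplicity-cycleNeighbours-edge (i , j , i→j , inj₁ (refl , refl)) rewrite cycleIndex-cyc i =
    cong₂ _+_ (trans (cong (λ k → δ (cyc k) (cyc j)) (cycNext-functional (cycNext-nextᶠ i) i→j)) (δ-refl (cyc j)))
              (cong (_+ 0) (δ-≢ λ e → cycNext-asym i→j (subst (λ k → CycNext m k i) (cyc-inj e) (cycNext-prevᶠ i))))
  multiplicity-cycleNeighbours-edge (i , j , i→j , inj₂ (refl , refl)) rewrite cycleIndex-cyc j =
    cong₂ _+_ (δ-≢ λ e → cycNext-asym i→j (subst (CycNext m j) (cyc-inj e) (cycNext-nextᶠ j)))
              (cong (_+ 0) (trans (cong (λ k → δ (cyc k) (cyc i)) (cycNext-injective (cycNext-prevᶠ j) i→j)) (δ-refl (cyc i))))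

  multiplicity-cycleNeighbours-nonEdge : ∀ {u w} → ¬ CycleEdge cyc u w → multiplicity (cycleNeighbours (cycleIndex u)) w ≡ 0
  multiplicity-cycleNeighbours-nonEdge {u} {w} ¬edge with cycleIndex u | cycleIndex-view u
  ... | nothing | _ = refl
  ... | just i | onCycle .i refl =
    cong₂ _+_ (δ-≢ λ e → ¬edge (i , nextᶠ i , cycNext-nextᶠ i , inj₁ (refl , sym e)))
              (cong (_+ 0) (δ-≢ λ e → ¬edge (prevᶠ i , i , cycNext-prevᶠ i , inj₂ (refl , sym e))))

  multiplicity-forward-next : ∀ {y z} → PathNext y z → multiplicity (forwardNeighbours y) (pth z) ≡ 1
  multiplicity-forward-next {y} {z} y→z with toℕ y <? l
  ... | yes y<l = cong (_+ 0) (trans (cong (λ k → δ (pth k) (pth z)) (toℕ-injective (trans (toℕ-fromℕ< (s≤s y<l)) y→z)))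
                                     (δ-refl (pth z)))
  ... | no y≮l  = ⊥-elim (y≮l (≤-pred (subst (_< suc l) (sym y→z) (toℕ<n z))))

  multiplicity-forward-other : ∀ {y w} → (∀ z → PathNext y z → pth z ≢ w) → multiplicity (forwardNeighbours y) w ≡ 0
  multiplicity-forward-other {y} ¬next with toℕ y <? l
  ... | yes y<l = cong (_+ 0) (δ-≢ (¬next _ (sym (toℕ-fromℕ< (s≤s y<l)))))
  ... | no _    = refl

  multiplicity-backward-prev : ∀ {y z} → PathNext y z → multiplicity (backwardNeighbours z) (pth y) ≡ 1
  multiplicity-backward-prev {y} {sucF z} y→z =
    cong (_+ 0) (trans (cong (λ k → δ (pth k) (pth y)) (toℕ-injective (trans (toℕ-inject₁ z) (sym (suc-injective y→z)))))
                       (δ-refl (pth y)))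

  multiplicity-backward-other : ∀ {z w} → (∀ y → PathNext y z → pth y ≢ w) → multiplicity (backwardNeighbours z) w ≡ 0
  multiplicity-backward-other {0F}     ¬prev = refl
  multiplicity-backward-other {sucF z} ¬prev = cong (_+ 0) (δ-≢ (¬prev (inject₁ z) (cong suc (toℕ-inject₁ z))))

  multiplicity-pathNeighbours-edge : ∀ {u w} → PathEdge pth u w → multiplicity (pathNeighbours (pathIndex u)) w ≡ 1
  multiplicity-pathNeighbours-edge (y , z , y→z , inj₁ (refl , refl)) rewrite pathIndex-pth y =
    trans (multiplicity-++ (forwardNeighbours y) _ (pth z))
          (cong₂ _+_ (multiplicity-forward-next y→z)
                     (multiplicity-backward-other λ x x→y e → pathNext-asym y→z (subst (λ k → PathNext k y) (pth-inj e) x→y)))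
  multiplicity-pathNeighbours-edge (y , z , y→z , inj₂ (refl , refl)) rewrite pathIndex-pth z =
    trans (multiplicity-++ (forwardNeighbours z) _ (pth y))
          (cong₂ _+_ (multiplicity-forward-other λ x z→x e → pathNext-asym y→z (subst (PathNext z) (pth-inj e) z→x))
                     (multiplicity-backward-prev y→z))

  multiplicity-pathNeighbours-nonEdge : ∀ {u w} → ¬ PathEdge pth u w → multiplicity (pathNeighbours (pathIndex u)) w ≡ 0
  multiplicity-pathNeighbours-nonEdge {u} {w} ¬edge with pathIndex u | pathIndex-view u
  ... | nothing | _ = refl
  ... | just y | onPath .y refl =
    trans (multiplicity-++ (forwardNeighbours y) _ w)
          (cong₂ _+_ (multiplicity-forward-other λ z y→z e → ¬edge (y , z , y→z , inj₁ (refl , sym e)))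
                     (multiplicity-backward-other λ x x→y e → ¬edge (x , y , x→y , inj₂ (refl , sym e))))

  multiplicity-neighbours : ∀ u w → multiplicity (neighbours u) w ≡ (if adj G u w then 1 else 0)
  multiplicity-neighbours u w = trans (multiplicity-++ (cycleNeighbours (cycleIndex u)) _ w) (by-adjacency (adj G u w) refl)
    where
    by-adjacency : ∀ b → adj G u w ≡ b →
      multiplicity (cycleNeighbours (cycleIndex u)) w + multiplicity (pathNeighbours (pathIndex u)) w ≡ (if b then 1 else 0)
    by-adjacency true uw with edges u w uw
    ... | inj₁ c = cong₂ _+_ (multiplicity-cycleNeighbours-edge c) (multiplicity-pathNeighbours-nonEdge (disjoint u w c))
    ... | inj₂ p = cong₂ _+_ (multiplicity-cycleNeighbours-nonEdge (λ c → disjoint u w c p)) (multiplicity-pathNeighbours-edge p)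
    by-adjacency false uw =
      cong₂ _+_ (multiplicity-cycleNeighbours-nonEdge (λ c → true≢false (trans (sym (cyc-sub u w c)) uw)))
                (multiplicity-pathNeighbours-nonEdge (λ p → true≢false (trans (sym (pth-sub u w p)) uw)))
      where
      true≢false : true ≢ false
      true≢false ()

  cycNext? : Decidable (CycNext m)
  cycNext? i j = (suc (toℕ i) ℕ.≟ toℕ j) ⊎-dec ((suc (toℕ i) ℕ.≟ m) ×-dec (toℕ j ℕ.≟ 0))

  pathNext? : Decidable (PathNext {suc l})
  pathNext? y z = suc (toℕ y) ℕ.≟ toℕ z

  onIndices : ∀ {I : Set} → (I → I → Fin 4 → Fin 4) → Maybe I → Maybe I → Fin 4 → Fin 4
  onIndices f (just i) (just j) d = f i j d
  onIndices f _        _        d = d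

  onIndices-sym : ∀ {I : Set} (f : I → I → Fin 4 → Fin 4) → (∀ i j d → f i j d ≡ f j i d) →
    ∀ a b d → onIndices f a b d ≡ onIndices f b a d
  onIndices-sym f f-sym (just i) (just j) d = f-sym i j d
  onIndices-sym f f-sym (just _) nothing  d = refl
  onIndices-sym f f-sym nothing  (just _) d = refl
  onIndices-sym f f-sym nothing  nothing  d = refl

  -- Edge colourings given along the cycle and the path

  -- cycleColour x colours the cycle edge x, pathColour y the path edge from pth y to pth (y + 1).
  module Coloured (cycleColour pathColour : ℕ → Fin 4) where

    module OnCycle = Oriented (CycNext m) cycNext? cycNext-asym (λ i → cycleColour (toℕ i))
    module OnPath  = Oriented PathNext pathNext? pathNext-asym (λ y → pathColour (toℕ y))

    pathColourOf : Fin n → Fin n → Fin 4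
    pathColourOf u w = onIndices OnPath.orientedColour (pathIndex u) (pathIndex w) 0F

    colour : Fin n → Fin n → Fin 4
    colour u w = onIndices OnCycle.orientedColour (cycleIndex u) (cycleIndex w) (pathColourOf u w)

    colour-sym : ∀ u w → colour u w ≡ colour w u
    colour-sym u w =
      trans (onIndices-sym OnCycle.orientedColour OnCycle.orientedColour-sym (cycleIndex u) (cycleIndex w) _)
            (cong (onIndices OnCycle.orientedColour (cycleIndex w) (cycleIndex u))
                  (onIndices-sym OnPath.orientedColour OnPath.orientedColour-sym (pathIndex u) (pathIndex w) 0F))

    colouring : EdgeColouring G 4
    colouring = record { col = colour ; col-sym = λ u w _ → colour-sym u w }

    colour-cycNext : ∀ {i j} → CycNext m i j → colour (cyc i) (cyc j) ≡ cycleColour (toℕ i)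
    colour-cycNext {i} {j} i→j rewrite cycleIndex-cyc i | cycleIndex-cyc j = OnCycle.orientedColour-step _ i→j

    colour-offCycle : ∀ {u w} → ¬ CycleEdge cyc u w → colour u w ≡ pathColourOf u w
    colour-offCycle {u} {w} ¬edge with cycleIndex u | cycleIndex-view u | cycleIndex w | cycleIndex-view w
    ... | just i  | onCycle .i refl | just j  | onCycle .j refl =
      OnCycle.orientedColour-nonStep _ (λ i→j → ¬edge (i , j , i→j , inj₁ (refl , refl)))
                                       (λ j→i → ¬edge (j , i , j→i , inj₂ (refl , refl)))
    ... | just _  | _ | nothing | _ = refl
    ... | nothing | _ | just _  | _ = refl
    ... | nothing | _ | nothing | _ = refl

    colour-pathNext : ∀ {y z} → PathNext y z → colour (pth y) (pth z) ≡ pathColour (toℕ y)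
    colour-pathNext {y} {z} y→z
      rewrite colour-offCycle (λ c → disjoint (pth y) (pth z) c (y , z , y→z , inj₁ (refl , refl)))
            | pathIndex-pth y | pathIndex-pth z = OnPath.orientedColour-step _ y→z

    cycleDegree : Fin 4 → ℕ → ℕ
    cycleDegree k x = δ (cycleColour x) k + δ (cycleColour (prev x)) k

    forwardDegree : Fin 4 → ℕ → ℕ
    forwardDegree k y with y <? l
    ... | yes _ = δ (pathColour y) k
    ... | no _  = 0

    forwardDegree-< : ∀ {k y} → y < l → forwardDegree k y ≡ δ (pathColour y) k
    forwardDegree-< {k} {y} y<l with y <? l
    ... | yes _   = refl
    ... | no y≮l = ⊥-elim (y≮l y<l)

    forwardDegree-≥ : ∀ {k y} → l ≤ y → forwardDegree k y ≡ 0
    forwardDegree-≥ {k} {y} l≤y with y <? l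
    ... | yes y<l = ⊥-elim (<-irrefl refl (≤-trans y<l l≤y))
    ... | no _    = refl

    forwardDegree≤1 : ∀ k y → forwardDegree k y ≤ 1
    forwardDegree≤1 k y with y <? l
    ... | yes _ = δ≤1 (pathColour y) k
    ... | no _  = z≤n

    backwardDegree : Fin 4 → ℕ → ℕ
    backwardDegree k zero    = 0
    backwardDegree k (suc y) = δ (pathColour y) k

    pathDegree : Fin 4 → ℕ → ℕ
    pathDegree k y = forwardDegree k y + backwardDegree k y

    pathDegree-tail : ∀ {x} → x < l → pathDegree (pathColour x) x ≡ suc (backwardDegree (pathColour x) x)
    pathDegree-tail {x} x<l = cong (_+ backwardDegree (pathColour x) x) (trans (forwardDegree-< x<l) (δ-refl (pathColour x)))

    pathDegree-head : ∀ x → pathDegree (pathColour x) (suc x) ≡ forwardDegree (pathColour x) (suc x) + 1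
    pathDegree-head x = cong (forwardDegree (pathColour x) (suc x) +_) (δ-refl (pathColour x))

    cyclePart pathPart degree : Fin 4 → Fin n → ℕ
    cyclePart k u = maybe (λ i → cycleDegree k (toℕ i)) 0 (cycleIndex u)
    pathPart  k u = maybe (λ y → pathDegree k (toℕ y)) 0 (pathIndex u)
    degree    k u = cyclePart k u + pathPart k u

    cyclePart-cyc : ∀ k i → cyclePart k (cyc i) ≡ cycleDegree k (toℕ i)
    cyclePart-cyc k i rewrite cycleIndex-cyc i = refl

    pathPart-pth : ∀ k y → pathPart k (pth y) ≡ pathDegree k (toℕ y)
    pathPart-pth k y rewrite pathIndex-pth y = refl

    cyclePart-zero : ∀ {k u} → (∀ i → cyc i ≡ u → cycleDegree k (toℕ i) ≡ 0) → cyclePart k u ≡ 0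
    cyclePart-zero {k} {u} vanishes with cycleIndex u | cycleIndex-view u
    ... | nothing | _                = refl
    ... | just i  | onCycle .i cyc≡u = vanishes i cyc≡u

    pathPart-zero : ∀ {k u} → (∀ y → pth y ≡ u → pathDegree k (toℕ y) ≡ 0) → pathPart k u ≡ 0
    pathPart-zero {k} {u} vanishes with pathIndex u | pathIndex-view u
    ... | nothing | _               = refl
    ... | just y  | onPath .y pth≡u = vanishes y pth≡u

    private
      colourSum : Fin 4 → Fin n → List (Fin n) → ℕ
      colourSum k u ws = listSum (map (λ w → δ (colour u w) k) ws)

      colourSum-cycle : ∀ k {u mi} → CycleView u mi → colourSum k u (cycleNeighbours mi) ≡ maybe (λ i → cycleDegree k (toℕ i)) 0 mi
      colourSum-cycle k (offCycle _)     = refl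
      colourSum-cycle k (onCycle i refl) =
        cong₂ _+_ (cong (λ c → δ c k) (colour-cycNext (cycNext-nextᶠ i)))
                  (trans (+-identityʳ _) (cong (λ c → δ c k) (trans (colour-sym (cyc i) (cyc (prevᶠ i)))
                                                             (trans (colour-cycNext (cycNext-prevᶠ i)) (cong cycleColour (toℕ-prevᶠ i))))))

      colourSum-forward : ∀ k y → colourSum k (pth y) (forwardNeighbours y) ≡ forwardDegree k (toℕ y)
      colourSum-forward k y with toℕ y <? l
      ... | yes y<l = trans (+-identityʳ _) (cong (λ c → δ c k) (colour-pathNext (sym (toℕ-fromℕ< (s≤s y<l)))))
      ... | no _    = refl

      colourSum-backward : ∀ k y → colourSum k (pth y) (backwardNeighbours y) ≡ backwardDegree k (toℕ y)
      colourSum-backward k 0F       = refl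
      colourSum-backward k (sucF y) =
        trans (+-identityʳ _) (cong (λ c → δ c k) (trans (colour-sym (pth (sucF y)) (pth (inject₁ y)))
                                                  (trans (colour-pathNext (cong suc (toℕ-inject₁ y))) (cong pathColour (toℕ-inject₁ y)))))

      colourSum-path : ∀ k {u my} → PathView u my → colourSum k u (pathNeighbours my) ≡ maybe (λ y → pathDegree k (toℕ y)) 0 my
      colourSum-path k (offPath _)     = refl
      colourSum-path k (onPath y refl) =
        trans (cong listSum (map-++ (λ w → δ (colour (pth y) w) k) (forwardNeighbours y) _))
              (trans (sum-++ (map (λ w → δ (colour (pth y) w) k) (forwardNeighbours y)) _)
                     (cong₂ _+_ (colourSum-forward k y) (colourSum-backward k y)))

    deg-colourClass : ∀ k u → deg (colourClass colouring k) u ≡ degree k u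
    deg-colourClass k u =
      trans (degree-by-neighbours colouring k u (neighbours u) (multiplicity-neighbours u))
      (trans (cong listSum (map-++ (λ w → δ (colour u w) k) (cycleNeighbours (cycleIndex u)) _))
      (trans (sum-++ (map (λ w → δ (colour u w) k) (cycleNeighbours (cycleIndex u))) _)
             (cong₂ _+_ (colourSum-cycle k (cycleIndex-view u)) (colourSum-path k (pathIndex-view u)))))

    colourClass-edge : ∀ {k u w} → colourClass colouring k u w ≡ true → adj G u w ≡ true × colour u w ≡ k
    colourClass-edge {k} {u} {w} uw∈k with adj G u w | colour u w ≟ k
    colourClass-edge _  | true  | yes c≡k = refl , c≡k
    colourClass-edge () | true  | no _
    colourClass-edge () | false | _

    isLocIrr-byEdges :
      (∀ i → degree (cycleColour (toℕ i)) (cyc i) ≢ degree (cycleColour (toℕ i)) (cyc (nextᶠ i))) →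
      (∀ {y z} → PathNext y z → degree (pathColour (toℕ y)) (pth y) ≢ degree (pathColour (toℕ y)) (pth z)) →
      IsLocIrrColouring colouring
    isLocIrr-byEdges cycle-edges path-edges k u w uw∈k deg≡ =
      irregular (edges u w uw) colour≡k (trans (sym (deg-colourClass k u)) (trans deg≡ (deg-colourClass k w)))
      where
      uw = proj₁ (colourClass-edge uw∈k)
      colour≡k = proj₂ (colourClass-edge uw∈k)

      cycle-edge : ∀ {i j} → CycNext m i j → colour (cyc i) (cyc j) ≡ k → degree k (cyc i) ≢ degree k (cyc j)
      cycle-edge {i} i→j refl rewrite colour-cycNext i→j | cycNext-functional i→j (cycNext-nextᶠ i) = cycle-edges i

      path-edge : ∀ {y z} → PathNext y z → colour (pth y) (pth z) ≡ k → degree k (pth y) ≢ degree k (pth z)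
      path-edge y→z refl rewrite colour-pathNext y→z = path-edges y→z

      irregular : ∀ {u w} → CycleEdge cyc u w ⊎ PathEdge pth u w → colour u w ≡ k → degree k u ≢ degree k w
      irregular (inj₁ (i , j , i→j , inj₁ (refl , refl))) c≡k = cycle-edge i→j c≡k
      irregular (inj₁ (i , j , i→j , inj₂ (refl , refl))) c≡k =
        λ d≡ → cycle-edge i→j (trans (colour-sym (cyc i) (cyc j)) c≡k) (sym d≡)
      irregular (inj₂ (y , z , y→z , inj₁ (refl , refl))) c≡k = path-edge y→z c≡k
      irregular (inj₂ (y , z , y→z , inj₂ (refl , refl))) c≡k =
        λ d≡ → path-edge y→z (trans (colour-sym (pth y) (pth z)) c≡k) (sym d≡)

    -- The two ends of cycle edge x get different degrees once the path adds β at cyc x and β′ at cyc (next x).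
    CycleEdgeIrregular : ℕ → ℕ → ℕ → Set
    CycleEdgeIrregular x β β′ =
      let k = cycleColour x in
      (δ k k + δ (cycleColour (prev x)) k) + β ≢ (δ (cycleColour (next x)) k + δ k k) + β′

    degree-cycleEdge-irregular : ∀ i → let k = cycleColour (toℕ i) in
      CycleEdgeIrregular (toℕ i) (pathPart k (cyc i)) (pathPart k (cyc (nextᶠ i))) →
      degree k (cyc i) ≢ degree k (cyc (nextᶠ i))
    degree-cycleEdge-irregular i irregular
      rewrite cyclePart-cyc (cycleColour (toℕ i)) i | cyclePart-cyc (cycleColour (toℕ i)) (nextᶠ i)
            | toℕ-nextᶠ i | prev-next (toℕ<n i) = irregular

    alternating-irregular : ∀ {x a b} → cycleColour (prev x) ≡ X a → cycleColour x ≡ X b → cycleColour (next x) ≡ X (a ⁻¹) →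
      CycleEdgeIrregular x 0 0
    alternating-irregular {x} {a} {b} prev≡ x≡ next≡
      rewrite prev≡ | x≡ | next≡ | δ-refl (X b) | +-identityʳ (suc (δ (X a) (X b))) | +-identityʳ (δ (X (a ⁻¹)) (X b) + 1) =
      δ-⁻¹-distinct X (λ ()) a b

    with-pathParts : ∀ {x β β′ b b′} → β ≡ b → β′ ≡ b′ → CycleEdgeIrregular x b b′ → CycleEdgeIrregular x β β′
    with-pathParts {x} β≡b β′≡b′ = subst₂ (CycleEdgeIrregular x) (sym β≡b) (sym β′≡b′)

    -- "middle": the vertex is the middle of a monochromatic pair of cycle edges;
    -- "hub": moreover the path adds edges of the same colour there.
    middle-start-irregular : ∀ {x β} → cycleColour (prev x) ≡ cycleColour x → cycleColour (next x) ≢ cycleColour x →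
      CycleEdgeIrregular x β 0
    middle-start-irregular {x} prev≡ next≢ rewrite prev≡ | δ-refl (cycleColour x) | δ-≢ next≢ = λ ()

    middle-end-irregular : ∀ {x β} → cycleColour (prev x) ≢ cycleColour x → cycleColour (next x) ≡ cycleColour x →
      CycleEdgeIrregular x 0 β
    middle-end-irregular {x} prev≢ next≡ rewrite next≡ | δ-refl (cycleColour x) | δ-≢ prev≢ = λ ()

    hub-start-irregular : ∀ {x β} → cycleColour (prev x) ≡ cycleColour x → CycleEdgeIrregular x (suc β) 0
    hub-start-irregular {x} prev≡ rewrite prev≡ | δ-refl (cycleColour x) with cycleColour (next x) ≟ cycleColour x
    ... | yes _ = λ ()
    ... | no _  = λ ()

    hub-end-irregular : ∀ {x β} → cycleColour (next x) ≡ cycleColour x → CycleEdgeIrregular x 0 (suc β)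
    hub-end-irregular {x} next≡ rewrite next≡ | δ-refl (cycleColour x) with cycleColour (prev x) ≟ cycleColour x
    ... | yes _ = λ ()
    ... | no _  = λ ()

  -- The colourings

  -- The first t path edges are X-coloured, the others follow the pair pattern in Y, so Y-classes see no cycle edge.
  module XYColouring (t : ℕ) (t≤2 : t ≤ 2) (prefixParity cycleParity : ℕ → Parity) where

    pathColour : ℕ → Fin 4
    pathColour y with y <? t
    ... | yes _ = X (prefixParity y)
    ... | no _  = Y (pairParity (y ∸ t))

    cycleColour : ℕ → Fin 4
    cycleColour x = X (cycleParity x)

    open Coloured cycleColour pathColour public

    pathColour-prefix : ∀ {y} → y < t → pathColour y ≡ X (prefixParity y)
    pathColour-prefix {y} y<t with y <? t
    ... | yes _   = refl
    ... | no y≮t = ⊥-elim (y≮t y<t)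

    pathColour-tail : ∀ {y} → t ≤ y → pathColour y ≡ Y (pairParity (y ∸ t))
    pathColour-tail {y} t≤y with y <? t
    ... | yes y<t = ⊥-elim (<-irrefl refl (≤-trans y<t t≤y))
    ... | no _    = refl

    forwardDegree-X-tail : ∀ p {y} → t ≤ y → forwardDegree (X p) y ≡ 0
    forwardDegree-X-tail p {y} t≤y with y <? l
    ... | yes _ = trans (cong (λ c → δ c (X p)) (pathColour-tail t≤y)) (δ-YX p (pairParity (y ∸ t)))
    ... | no _  = refl

    pathDegree-X-beyond : ∀ p {y} → t < y → pathDegree (X p) y ≡ 0
    pathDegree-X-beyond p {suc y} t<y+1 =
      cong₂ _+_ (forwardDegree-X-tail p (<⇒≤ t<y+1))
                (trans (cong (λ c → δ c (X p)) (pathColour-tail (≤-pred t<y+1))) (δ-YX p (pairParity (y ∸ t))))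

    cyclePart-Y : ∀ q u → cyclePart (Y q) u ≡ 0
    cyclePart-Y q u = cyclePart-zero (λ i _ → cong₂ _+_ (δ-XY (cycleParity (toℕ i)) q) (δ-XY (cycleParity (prev (toℕ i))) q))

    degree-Y-pth : ∀ {q} y → ∀ {k} → k ≡ Y q → degree k (pth y) ≡ pathDegree k (toℕ y)
    degree-Y-pth {q} y refl = cong₂ _+_ (cyclePart-Y q (pth y)) (pathPart-pth (Y q) y)

    pathPart-v : ∀ k → pathPart k v ≡ forwardDegree k 0
    pathPart-v k = trans (cong (pathPart k) (sym pth-v)) (trans (pathPart-pth k 0F) (+-identityʳ _))

    pathPart-X-beyond : ∀ p {u} → (∀ y → pth y ≡ u → t < toℕ y) → pathPart (X p) u ≡ 0
    pathPart-X-beyond p beyond = pathPart-zero (λ y y≡u → pathDegree-X-beyond p (beyond y y≡u))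

    offHub-beyondPrefix : ∀ {i} → toℕ i ≢ 0 → (∀ y → pth y ≡ cyc i → toℕ y ≡ 2 → t < 2) → ∀ y → pth y ≡ cyc i → t < toℕ y
    offHub-beyondPrefix {i} i≢0 pth₂-beyond y y≡i with toℕ y in y≡
    ... | 0 = ⊥-elim (i≢0 (trans (cong toℕ (cyc-inj i≡v)) (toℕ-fromℕ< 0<m)))
      where
      i≡v : cyc i ≡ cyc (fromℕ< 0<m)
      i≡v = trans (sym y≡i) (trans (cong pth (toℕ-injective y≡)) (trans pth-v (sym v-on-cycle)))
    ... | 1 = ⊥-elim (pth₁-offCycle y≡ i (sym y≡i))
    ... | 2 = pth₂-beyond y y≡i y≡
    ... | suc (suc (suc _)) = s≤s (≤-trans t≤2 (s≤s (s≤s z≤n)))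

    pathColour-tail′ : ∀ j → pathColour (t + j) ≡ Y (pairParity j)
    pathColour-tail′ j = trans (pathColour-tail (m≤m+n t j)) (cong (λ i → Y (pairParity i)) (m+n∸m≡n t j))

    -- An even tail ends with a complete pair.
    module Tail (even-tail : parity l ≡ parity t) where

      tail-length-even : ∀ {j} → t + j ≡ l → parity j ≡ 0ℙ
      tail-length-even {j} t+j≡l = ℙ.+-cancelˡ-≡ (parity t) (parity j) 0ℙ (begin
        parity t ℙ.+ parity j    ≡⟨ sym (ℙ.+-homo-+ t j) ⟩
        parity (t + j)           ≡⟨ cong parity t+j≡l ⟩
        parity l                 ≡⟨ even-tail ⟩
        parity t                 ≡⟨ sym (ℙ.+-identityʳ (parity t)) ⟩
        parity t ℙ.+ 0ℙ          ∎)
        where open ≡-Reasoning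

      backward-tail : ∀ j → backwardDegree (Y (pairParity (suc j))) (t + suc j) ≡ δ (Y (pairParity j)) (Y (pairParity (suc j)))
      backward-tail j = trans (cong (backwardDegree _) (+-suc t j)) (cong (λ c → δ c _) (pathColour-tail′ j))

      tail-step : ∀ j → t + j < l →
        let k = Y (pairParity j) in suc (backwardDegree k (t + j)) ≢ forwardDegree k (suc (t + j)) + 1
      tail-step zero t<l eq = 1≢2 (trans (cong suc (sym backward)) (trans eq (cong (_+ 1) forward)))
        where
        1≢2 : 1 ≢ 2
        1≢2 ()
        backward : backwardDegree (Y 0ℙ) (t + 0) ≡ 0
        backward = trans (cong (backwardDegree (Y 0ℙ)) (+-identityʳ t)) (start t ≤-refl)
          where
          start : ∀ s → s ≤ t → backwardDegree (Y 0ℙ) s ≡ 0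
          start zero    _   = refl
          start (suc s) s<t = trans (cong (λ c → δ c (Y 0ℙ)) (pathColour-prefix s<t)) (δ-XY (prefixParity s) 0ℙ)
        t+1<l : suc (t + 0) < l
        t+1<l = ≤∧≢⇒< t<l (λ t+1≡l → contradiction (tail-length-even (trans (+-suc t 0) t+1≡l)) λ ())
        forward : forwardDegree (Y 0ℙ) (suc (t + 0)) ≡ 1
        forward = trans (forwardDegree-< t+1<l)
                        (cong (λ c → δ c (Y 0ℙ)) (trans (cong pathColour (sym (+-suc t 0))) (pathColour-tail′ 1)))
      tail-step (suc j) t+j+1<l eq with suc (t + suc j) ℕ.≟ l
      ... | yes t+j+2≡l = 2≢1 (trans (cong suc backward) (trans eq (cong (_+ 1) (forwardDegree-≥ (≤-reflexive (sym t+j+2≡l))))))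
        where
        2≢1 : 2 ≢ 1
        2≢1 ()
        pair : pairParity (suc j) ≡ pairParity j
        pair = pairParity-even {j} (tail-length-even (trans (+-suc t (suc j)) t+j+2≡l))
        backward : 1 ≡ backwardDegree (Y (pairParity (suc j))) (t + suc j)
        backward = trans (sym (δ-refl (Y (pairParity j))))
                         (trans (cong (λ p → δ (Y (pairParity j)) (Y p)) (sym pair)) (sym (backward-tail j)))
      ... | no t+j+2≢l = δ-⁻¹-distinct Y (λ ()) (pairParity j) (pairParity (suc j))
          (trans (cong suc (sym (backward-tail j))) (trans eq (cong (_+ 1) forward)))
        where
        forward : forwardDegree (Y (pairParity (suc j))) (suc (t + suc j)) ≡ δ (Y (pairParity j ⁻¹)) (Y (pairParity (suc j)))
        forward = trans (forwardDegree-< (≤∧≢⇒< t+j+1<l t+j+2≢l))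
                        (cong (λ c → δ c _) (trans (cong pathColour (sym (+-suc t (suc j))))
                                            (trans (pathColour-tail′ (suc (suc j))) (cong Y (pairParity-+2 j)))))

      tail-pathDegree : ∀ j → t + j < l → pathDegree (pathColour (t + j)) (t + j) ≢ pathDegree (pathColour (t + j)) (suc (t + j))
      tail-pathDegree j t+j<l rewrite pathDegree-tail t+j<l | pathDegree-head (t + j) | pathColour-tail′ j = tail-step j t+j<l

      tail-irregular : ∀ {y z} → PathNext y z → t ≤ toℕ y →
        degree (pathColour (toℕ y)) (pth y) ≢ degree (pathColour (toℕ y)) (pth z)
      tail-irregular {y} {z} y→z t≤y
        rewrite degree-Y-pth y (pathColour-tail t≤y) | degree-Y-pth z (pathColour-tail t≤y) | sym y→z =
        subst (λ x → pathDegree (pathColour x) x ≢ pathDegree (pathColour x) (suc x)) (m+[n∸m]≡n t≤y)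
              (tail-pathDegree (toℕ y ∸ t) (subst (_< l) (sym (m+[n∸m]≡n t≤y)) y<l))
        where
        y<l : toℕ y < l
        y<l = ≤-pred (subst (_< suc l) (sym y→z) (toℕ<n z))

    pathPart-offHub : ∀ {i p} → toℕ i ≢ 0 → (∀ y → pth y ≡ cyc i → toℕ y ≡ 2 → t < 2) → pathPart (X p) (cyc i) ≡ 0
    pathPart-offHub {p = p} i≢0 pth₂-beyond = pathPart-X-beyond p (offHub-beyondPrefix i≢0 pth₂-beyond)

    degree-v : ∀ k → degree k v ≡ cycleDegree k 0 + forwardDegree k 0
    degree-v k =
      cong₂ _+_ (trans (cong (cyclePart k) (sym v-on-cycle)) (trans (cyclePart-cyc k _) (cong (cycleDegree k) (toℕ-fromℕ< 0<m))))
                (pathPart-v k)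

    degree-pth₁ : ∀ {k y} → toℕ y ≡ 1 → degree k (pth y) ≡ pathDegree k 1
    degree-pth₁ {k} {y} y≡1 =
      cong₂ _+_ (cyclePart-zero (λ i i≡y → ⊥-elim (pth₁-offCycle y≡1 i i≡y))) (trans (pathPart-pth k y) (cong (pathDegree k) y≡1))

    first-edge-irregular : 0 < t → prefixParity 0 ≡ 0ℙ → cycleParity 0 ≡ 0ℙ → cycleParity (prev 0) ≡ 0ℙ →
      ∀ {y z} → toℕ y ≡ 0 → PathNext y z → degree (pathColour (toℕ y)) (pth y) ≢ degree (pathColour (toℕ y)) (pth z)
    first-edge-irregular 0<t first≡ c0≡ c-1≡ {y} {z} y≡0 y→z with toℕ-injective {i = y} {j = 0F} y≡0
    ... | refl rewrite pathColour-prefix 0<t | first≡ = λ deg≡ →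
      3≢≤2 (forwardDegree≤1 (X 0ℙ) 1) (trans (sym at-v) (trans deg≡ at-next))
      where
      3≢≤2 : ∀ {d} → d ≤ 1 → 3 ≢ d + 1
      3≢≤2 z≤n       ()
      3≢≤2 (s≤s z≤n) ()
      0<l : 0 < l
      0<l = subst (_≤ l) (sym y→z) (≤-pred (toℕ<n z))
      first-colour : pathColour 0 ≡ X 0ℙ
      first-colour = trans (pathColour-prefix 0<t) (cong X first≡)
      at-v : degree (X 0ℙ) (pth 0F) ≡ 3
      at-v = begin
        degree (X 0ℙ) (pth 0F)                         ≡⟨ cong (degree (X 0ℙ)) pth-v ⟩
        degree (X 0ℙ) v                                ≡⟨ degree-v (X 0ℙ) ⟩
        cycleDegree (X 0ℙ) 0 + forwardDegree (X 0ℙ) 0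
          ≡⟨ cong₂ _+_ (cong₂ _+_ (cong (λ p → δ (X p) (X 0ℙ)) c0≡) (cong (λ p → δ (X p) (X 0ℙ)) c-1≡))
                       (trans (forwardDegree-< 0<l) (cong (λ c → δ c (X 0ℙ)) first-colour)) ⟩
        3                                              ∎
        where open ≡-Reasoning
      at-next : degree (X 0ℙ) (pth z) ≡ forwardDegree (X 0ℙ) 1 + 1
      at-next = trans (degree-pth₁ (sym y→z)) (cong (forwardDegree (X 0ℙ) 1 +_) (cong (λ c → δ c (X 0ℙ)) first-colour))

    pathPart-atV : ∀ {i k} → 0 < t → 0 < l → toℕ i ≡ 0 → pathPart k (cyc i) ≡ δ (X (prefixParity 0)) k
    pathPart-atV {i} {k} 0<t 0<l i≡0 =
      trans (cong (pathPart k) (cyc-v i i≡0))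
            (trans (pathPart-v k) (trans (forwardDegree-< 0<l) (cong (λ c → δ c k) (pathColour-prefix 0<t))))

  -- m ≡ 0 (mod 4): the pairs (m-1, 0), (1, 2), … alternate all around the cycle.
  module PairedCycle (m-even : parity m ≡ 0ℙ) (m%4≡0 : pairParity m ≡ 0ℙ)
                     (t : ℕ) (t≤1 : t ≤ 1) (even-tail : parity l ≡ parity t) where
    open XYColouring t (≤-trans t≤1 (n≤1+n 1)) (λ _ → 0ℙ) (λ x → pairParity (suc x)) public
    open Tail even-tail

    wrap≡ : pairParity (suc (prev 0)) ≡ 0ℙ
    wrap≡ = trans (cong pairParity suc-pred-m) m%4≡0

    cycle-irregular : ∀ x → x < m → ∀ {β β′} → (x ≢ 0 → β ≡ 0) → (next x ≢ 0 → β′ ≡ 0) → CycleEdgeIrregular x β β′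
    cycle-irregular x x<m β≡0 β′≡0 with cyclePosition x<m
    ... | first =
      with-pathParts refl (β′≡0 (λ e → 1+n≢0 (trans (sym next-0) e))) (middle-start-irregular (cong X wrap≡) next≢)
      where
      next≢ : cycleColour (next 0) ≢ cycleColour 0
      next≢ rewrite next-0 = λ ()
    ... | last {x′} x+2≡m = with-pathParts (β≡0 (λ ())) refl (middle-end-irregular prev≢ next≡)
      where
      next≡ : cycleColour (next (suc x′)) ≡ cycleColour (suc x′)
      next≡ rewrite next-last x+2≡m = cong X (sym (trans (cong pairParity x+2≡m) m%4≡0))
      prev≢ : cycleColour x′ ≢ cycleColour (suc x′)
      prev≢ e = X-⁻¹ _ (trans (sym e) (cong X (pairParity-before-even {suc x′} (trans (cong parity x+2≡m) m-even))))
    ... | middle {x′} x+2<m =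
      with-pathParts (β≡0 (λ ())) (β′≡0 (λ e → 1+n≢0 (trans (sym (next-< x+2<m)) e))) (alternating-irregular refl refl next≡)
      where
      next≡ : cycleColour (next (suc x′)) ≡ X (pairParity (suc x′) ⁻¹)
      next≡ rewrite next-< x+2<m = cong X (pairParity-+2 (suc x′))

    path-irregular : ∀ {y z} → PathNext y z → degree (pathColour (toℕ y)) (pth y) ≢ degree (pathColour (toℕ y)) (pth z)
    path-irregular {y} y→z with t ≤? toℕ y
    ... | yes t≤y = tail-irregular y→z t≤y
    ... | no  y≱t = first-edge-irregular (subst (_< t) y≡0 (≰⇒> y≱t)) refl refl wrap≡ y≡0 y→z
      where
      y≡0 : toℕ y ≡ 0
      y≡0 = n<1⇒n≡0 (≤-trans (≰⇒> y≱t) t≤1)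

    irregular : IsLocIrrColouring colouring
    irregular = isLocIrr-byEdges
      (λ i → degree-cycleEdge-irregular i
        (cycle-irregular (toℕ i) (toℕ<n i) noPathPart (λ next≢0 → noPathPart (λ e → next≢0 (trans (sym (toℕ-nextᶠ i)) e)))))
      path-irregular
      where
      noPathPart : ∀ {i p} → toℕ i ≢ 0 → pathPart (X p) (cyc i) ≡ 0
      noPathPart i≢0 = pathPart-offHub i≢0 (λ _ _ _ → s≤s t≤1)

  -- m ≡ 2 (mod 4): the pairs (0, 1), …, (m-2, m-1) alternate except at v, where the first t path edges make a hub.
  module HubAtV (m-even : parity m ≡ 0ℙ) (m%4≡2 : pairParity m ≡ 1ℙ)
                (t : ℕ) (1≤t : 1 ≤ t) (t≤2 : t ≤ 2) (t≤l : t ≤ l) (even-tail : parity l ≡ parity t)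
                (pth₂-beyond : ∀ y i → pth y ≡ cyc i → toℕ y ≡ 2 → t < 2) where
    open XYColouring t t≤2 (λ _ → 0ℙ) pairParity public
    open Tail even-tail

    last-edge-parity : ∀ {x} → suc x ≡ m → pairParity x ≡ 0ℙ
    last-edge-parity {x} x+1≡m =
      trans (pairParity-before-even {x} (trans (cong parity x+1≡m) m-even)) (cong _⁻¹ (trans (cong pairParity x+1≡m) m%4≡2))

    cycle-irregular : ∀ x → x < m → ∀ {β β′} →
      (x ≡ 0 → β ≡ δ (X 0ℙ) (cycleColour x)) → (x ≢ 0 → β ≡ 0) →
      (next x ≡ 0 → β′ ≡ δ (X 0ℙ) (cycleColour x)) → (next x ≢ 0 → β′ ≡ 0) → CycleEdgeIrregular x β β′
    cycle-irregular x x<m β-v β-0 β′-v β′-0 with cyclePosition x<m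
    ... | first =
      with-pathParts (β-v refl) (β′-0 (λ e → 1+n≢0 (trans (sym next-0) e)))
                     (hub-start-irregular (cong X (last-edge-parity suc-pred-m)))
    ... | last {x′} x+2≡m =
      with-pathParts (β-0 (λ ())) (trans (β′-v (next-last x+2≡m)) (cong (λ p → δ (X 0ℙ) (X p)) (last-edge-parity x+2≡m)))
                     (hub-end-irregular (cong X (trans (cong pairParity (next-last x+2≡m)) (sym (last-edge-parity x+2≡m)))))
    ... | middle {x′} x+2<m =
      with-pathParts (β-0 (λ ())) (β′-0 (λ e → 1+n≢0 (trans (sym (next-< x+2<m)) e)))
                     (alternating-irregular refl refl (cong X (trans (cong pairParity (next-< x+2<m)) (pairParity-+2 x′))))

    second-edge-irregular : 1 < t → ∀ {y z} → toℕ y ≡ 1 → PathNext y z →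
      degree (pathColour (toℕ y)) (pth y) ≢ degree (pathColour (toℕ y)) (pth z)
    second-edge-irregular 1<t {y} {z} y≡1 y→z rewrite y≡1 | pathColour-prefix 1<t =
      λ deg≡ → 2≢1 (trans (sym at-y) (trans deg≡ at-z))
      where
      2≢1 : 2 ≢ 1
      2≢1 ()
      colour-0 : pathColour 0 ≡ X 0ℙ
      colour-0 = pathColour-prefix (≤-trans (s≤s z≤n) 1<t)
      z≡2 : toℕ z ≡ 2
      z≡2 = sym y→z
      at-y : degree (X 0ℙ) (pth y) ≡ 2
      at-y = trans (degree-pth₁ y≡1)
                   (cong₂ _+_ (trans (forwardDegree-< (≤-trans 1<t t≤l)) (cong (λ c → δ c (X 0ℙ)) (pathColour-prefix 1<t)))
                              (cong (λ c → δ c (X 0ℙ)) colour-0))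
      at-z : degree (X 0ℙ) (pth z) ≡ 1
      at-z = cong₂ _+_ (cyclePart-zero λ i i≡z → ⊥-elim (<-irrefl refl (≤-trans 1<t (≤-pred (pth₂-beyond z i (sym i≡z) z≡2)))))
                       (trans (pathPart-pth (X 0ℙ) z)
                              (trans (cong (pathDegree (X 0ℙ)) z≡2)
                                     (cong₂ _+_ (forwardDegree-X-tail 0ℙ t≤2) (cong (λ c → δ c (X 0ℙ)) (pathColour-prefix 1<t)))))

    path-irregular : ∀ {y z} → PathNext y z → degree (pathColour (toℕ y)) (pth y) ≢ degree (pathColour (toℕ y)) (pth z)
    path-irregular {y} {z} y→z with t ≤? toℕ y
    ... | yes t≤y = tail-irregular y→z t≤y
    ... | no  y≱t = prefix-edge (toℕ y) refl (≰⇒> y≱t)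
      where
      prefix-edge : ∀ j → toℕ y ≡ j → j < t → degree (pathColour (toℕ y)) (pth y) ≢ degree (pathColour (toℕ y)) (pth z)
      prefix-edge 0             y≡0 _   =
        first-edge-irregular (≤-trans (s≤s z≤n) 1≤t) refl refl (last-edge-parity suc-pred-m) y≡0 y→z
      prefix-edge 1             y≡1 1<t = second-edge-irregular 1<t y≡1 y→z
      prefix-edge (suc (suc _)) _   j<t = ⊥-elim (<-irrefl refl (≤-trans j<t (≤-trans t≤2 (s≤s (s≤s z≤n)))))

    irregular : IsLocIrrColouring colouring
    irregular = isLocIrr-byEdges
      (λ i → degree-cycleEdge-irregular i
        (cycle-irregular (toℕ i) (toℕ<n i) (pathPart-atV 1≤t 0<l) noPathPart
                         (λ next≡0 → pathPart-atV 1≤t 0<l (trans (toℕ-nextᶠ i) next≡0))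
                         (λ next≢0 → noPathPart (λ e → next≢0 (trans (sym (toℕ-nextᶠ i)) e)))))
      path-irregular
      where
      0<l : 0 < l
      0<l = ≤-trans 1≤t t≤l
      noPathPart : ∀ {i p} → toℕ i ≢ 0 → pathPart (X p) (cyc i) ≡ 0
      noPathPart {i} i≢0 = pathPart-offHub i≢0 (λ y → pth₂-beyond y i)

  -- m ≡ 2 (mod 4), l even and pth 2 = cyc θ: the pair patterns f before θ and g from θ on are phased so that
  -- both cycle edges at v get colour X 0ℙ and both at cyc θ get X 1ℙ, making v and cyc θ hubs.
  module HubsAtVAndθ (m-even : parity m ≡ 0ℙ) (l≥2 : 2 ≤ l) (even-tail : parity l ≡ 0ℙ)
                     (y₂ : Fin (suc l)) (y₂≡2 : toℕ y₂ ≡ 2) (θ : Fin m) (θ≡y₂ : cyc θ ≡ pth y₂)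
                     (θ-even : parity (toℕ θ) ≡ 0ℙ) (f g : ℕ → Parity)
                     (f-alternates : ∀ x → f (suc (suc x)) ≡ f x ⁻¹) (g-alternates : ∀ x → g (suc (suc x)) ≡ g x ⁻¹)
                     (f-0 : f 0 ≡ 0ℙ) (f-θ : ∀ {x} → suc x ≡ toℕ θ → f x ≡ 1ℙ)
                     (g-θ : g (toℕ θ) ≡ 1ℙ) (g-last : g (pred m) ≡ 0ℙ) where

    I : ℕ
    I = toℕ θ

    prefixParity : ℕ → Parity
    prefixParity zero    = 0ℙ
    prefixParity (suc _) = 1ℙ

    cycleParity : ℕ → Parity
    cycleParity x with x <? I
    ... | yes _ = f x
    ... | no _  = g x

    open XYColouring 2 ≤-refl prefixParity cycleParity public
    open Tail even-tail

    I≢0 : I ≢ 0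
    I≢0 I≡0 = 2≢0 (trans (sym y₂≡2) (cong toℕ (pth-inj (trans (sym θ≡y₂) (trans (cyc-v θ I≡0) (sym pth-v))))))
      where
      2≢0 : 2 ≢ 0
      2≢0 ()

    1<I : 1 < I
    1<I = even-nonzero⇒2≤ I≢0 θ-even

    I+1<m : suc I < m
    I+1<m = ≤∧≢⇒< (toℕ<n θ) (λ I+1≡m → ℙ.p≢p⁻¹ 0ℙ (trans (sym m-even) (trans (cong parity (sym I+1≡m)) I+1-odd)))
      where
      I+1-odd : parity (suc I) ≡ 1ℙ
      I+1-odd = trans (parity-suc I) (cong _⁻¹ θ-even)

    cycleParity-low : ∀ {x} → x < I → cycleParity x ≡ f x
    cycleParity-low {x} x<I with x <? I
    ... | yes _   = refl
    ... | no x≮I = ⊥-elim (x≮I x<I)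

    cycleParity-high : ∀ {x} → I ≤ x → cycleParity x ≡ g x
    cycleParity-high {x} I≤x with x <? I
    ... | yes x<I = ⊥-elim (<-irrefl refl (≤-trans x<I I≤x))
    ... | no _    = refl

    cycleParity-alternates : ∀ x → suc (suc x) ≢ I → suc x ≢ I → cycleParity (suc (suc x)) ≡ cycleParity x ⁻¹
    cycleParity-alternates x x+2≢I x+1≢I with I ≤? suc (suc x)
    ... | no I≰x+2 =
      trans (cycleParity-low x+2<I) (trans (f-alternates x) (cong _⁻¹ (sym (cycleParity-low (<⇒≤ (<⇒≤ x+2<I))))))
      where
      x+2<I = ≰⇒> I≰x+2
    ... | yes I≤x+2 = trans (cycleParity-high I≤x+2) (trans (g-alternates x) (cong _⁻¹ (sym (cycleParity-high I≤x))))
      where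
      I≤x = ≤-pred (≤∧≢⇒< (≤-pred (≤∧≢⇒< I≤x+2 (x+2≢I ∘ sym))) (x+1≢I ∘ sym))

    HubPathPart : ℕ → Fin 4 → ℕ → Set
    HubPathPart x k β = (x ≡ 0 → β ≡ δ (X 0ℙ) k) × (x ≡ I → β ≡ δ (X 1ℙ) k) × (x ≢ 0 → x ≢ I → β ≡ 0)

    parity-0 : cycleParity 0 ≡ 0ℙ
    parity-0 = trans (cycleParity-low (≤-trans (s≤s z≤n) 1<I)) f-0

    parity-wrap : cycleParity (prev 0) ≡ 0ℙ
    parity-wrap = trans (cycleParity-high (≤-pred (subst (suc I ≤_) (sym suc-pred-m) (toℕ<n θ)))) g-last

    colour-0 : cycleColour 0 ≡ X 0ℙ
    colour-0 = cong X parity-0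

    colour-wrap : cycleColour (prev 0) ≡ X 0ℙ
    colour-wrap = cong X parity-wrap

    colour-before-θ : cycleColour (pred I) ≡ X 1ℙ
    colour-before-θ = cong X (trans (cycleParity-low (≤-reflexive (suc-pred-I))) (f-θ suc-pred-I))
      where
      suc-pred-I : suc (pred I) ≡ I
      suc-pred-I = suc-pred I ⦃ ≢-nonZero I≢0 ⦄

    colour-θ : cycleColour I ≡ X 1ℙ
    colour-θ = cong X (trans (cycleParity-high ≤-refl) g-θ)

    cycle-irregular : ∀ x → x < m → ∀ {β β′} → HubPathPart x (cycleColour x) β → HubPathPart (next x) (cycleColour x) β′ →
      CycleEdgeIrregular x β β′
    cycle-irregular x x<m (β-v , β-θ , β-0) (β′-v , β′-θ , β′-0) with cyclePosition x<m
    ... | first =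
      with-pathParts (trans (β-v refl) (cong (δ (X 0ℙ)) colour-0))
                     (β′-0 (λ e → 1+n≢0 (trans (sym next-0) e)) (λ e → <-irrefl (trans (sym next-0) e) 1<I))
                     (hub-start-irregular (trans colour-wrap (sym colour-0)))
    ... | last {x′} x+2≡m =
      with-pathParts (β-0 (λ ()) (λ x+1≡I → <-irrefl (trans (cong suc (sym x+1≡I)) x+2≡m) I+1<m))
                     (trans (β′-v (next-last x+2≡m)) (cong (δ (X 0ℙ)) colour-x))
                     (hub-end-irregular (trans (cong cycleColour (next-last x+2≡m)) (trans colour-0 (sym colour-x))))
      where
      colour-x : cycleColour (suc x′) ≡ X 0ℙ
      colour-x = trans (cong (λ k → cycleColour (pred k)) x+2≡m) colour-wrap
    ... | middle {x′} x+2<m with suc (suc x′) ℕ.≟ I | suc x′ ℕ.≟ I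
    ...   | yes x+2≡I | _ =
      with-pathParts (β-0 (λ ()) (λ x+1≡I → 1+n≢n (trans x+2≡I (sym x+1≡I))))
                     (trans (β′-θ (trans (next-< x+2<m) x+2≡I)) (cong (δ (X 1ℙ)) colour-x))
                     (hub-end-irregular (trans (cong cycleColour (trans (next-< x+2<m) x+2≡I)) (trans colour-θ (sym colour-x))))
      where
      colour-x : cycleColour (suc x′) ≡ X 1ℙ
      colour-x = trans (cong (λ k → cycleColour (pred k)) x+2≡I) colour-before-θ
    ...   | no x+2≢I | yes x+1≡I =
      with-pathParts (trans (β-θ x+1≡I) (cong (δ (X 1ℙ)) colour-x))
                     (β′-0 (λ e → 1+n≢0 (trans (sym (next-< x+2<m)) e)) (λ e → x+2≢I (trans (sym (next-< x+2<m)) e)))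
                     (hub-start-irregular (trans (cong (λ k → cycleColour (pred k)) x+1≡I) (trans colour-before-θ (sym colour-x))))
      where
      colour-x : cycleColour (suc x′) ≡ X 1ℙ
      colour-x = trans (cong cycleColour x+1≡I) colour-θ
    ...   | no x+2≢I | no x+1≢I =
      with-pathParts (β-0 (λ ()) x+1≢I)
                     (β′-0 (λ e → 1+n≢0 (trans (sym (next-< x+2<m)) e)) (λ e → x+2≢I (trans (sym (next-< x+2<m)) e)))
                     (alternating-irregular refl refl
                        (cong X (trans (cong cycleParity (next-< x+2<m)) (cycleParity-alternates x′ x+2≢I x+1≢I))))

    0<l : 0 < l
    0<l = ≤-trans (s≤s z≤n) l≥2

    pathPart-atθ : ∀ p → pathPart (X p) (cyc θ) ≡ δ (X 1ℙ) (X p)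
    pathPart-atθ p =
      trans (cong (pathPart (X p)) θ≡y₂) (trans (pathPart-pth (X p) y₂) (trans (cong (pathDegree (X p)) y₂≡2)
            (cong₂ _+_ (forwardDegree-X-tail p ≤-refl) (cong (λ c → δ c (X p)) (pathColour-prefix (s≤s (s≤s z≤n)))))))

    hubPathPart : ∀ p j {x} → toℕ j ≡ x → HubPathPart x (X p) (pathPart (X p) (cyc j))
    hubPathPart p j refl =
        pathPart-atV (s≤s z≤n) 0<l
      , (λ j≡I → trans (cong (λ k → pathPart (X p) (cyc k)) (toℕ-injective j≡I)) (pathPart-atθ p))
      , λ j≢0 j≢I → pathPart-offHub j≢0 (λ y y≡j y≡2 → ⊥-elim (j≢I (cong toℕ (only-θ y≡j y≡2))))
      where
      only-θ : ∀ {y} → pth y ≡ cyc j → toℕ y ≡ 2 → j ≡ θ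
      only-θ {y} y≡j y≡2 = cyc-inj (trans (sym y≡j) (trans (cong pth (toℕ-injective (trans y≡2 (sym y₂≡2)))) (sym θ≡y₂)))

    prev-θ : prev I ≡ pred I
    prev-θ with I | I≢0
    ... | zero  | I≢0 = ⊥-elim (I≢0 refl)
    ... | suc _ | _   = refl

    θ-edge-irregular : ∀ {y z} → toℕ y ≡ 1 → PathNext y z →
      degree (pathColour (toℕ y)) (pth y) ≢ degree (pathColour (toℕ y)) (pth z)
    θ-edge-irregular {y} {z} y≡1 y→z rewrite y≡1 | pathColour-prefix {1} (s≤s (s≤s z≤n)) =
      λ deg≡ → 1≢3 (trans (sym at-y) (trans deg≡ at-θ))
      where
      1≢3 : 1 ≢ 3
      1≢3 ()
      at-y : degree (X 1ℙ) (pth y) ≡ 1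
      at-y = trans (degree-pth₁ y≡1)
                   (cong₂ _+_ (trans (forwardDegree-< l≥2) (cong (λ c → δ c (X 1ℙ)) (pathColour-prefix (s≤s (s≤s z≤n)))))
                              (cong (λ c → δ c (X 1ℙ)) (pathColour-prefix (s≤s z≤n))))
      z≡θ : pth z ≡ cyc θ
      z≡θ = trans (cong pth (toℕ-injective (trans (sym y→z) (sym y₂≡2)))) (sym θ≡y₂)
      at-θ : degree (X 1ℙ) (pth z) ≡ 3
      at-θ = begin
        degree (X 1ℙ) (pth z)                                          ≡⟨ cong (degree (X 1ℙ)) z≡θ ⟩
        cyclePart (X 1ℙ) (cyc θ) + pathPart (X 1ℙ) (cyc θ)             ≡⟨ cong₂ _+_ (cyclePart-cyc (X 1ℙ) θ) (pathPart-atθ 1ℙ) ⟩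
        (δ (cycleColour I) (X 1ℙ) + δ (cycleColour (prev I)) (X 1ℙ)) + 1
            ≡⟨ cong (_+ 1) (cong₂ _+_ (cong (λ c → δ c (X 1ℙ)) colour-θ)
                                      (cong (λ c → δ c (X 1ℙ)) (trans (cong cycleColour prev-θ) colour-before-θ))) ⟩
        3                                                              ∎
        where open ≡-Reasoning

    path-irregular : ∀ {y z} → PathNext y z → degree (pathColour (toℕ y)) (pth y) ≢ degree (pathColour (toℕ y)) (pth z)
    path-irregular {y} {z} y→z with 2 ≤? toℕ y
    ... | yes 2≤y = tail-irregular y→z 2≤y
    ... | no  y≱2 = prefix-edge (toℕ y) refl (≰⇒> y≱2)
      where
      prefix-edge : ∀ j → toℕ y ≡ j → j < 2 → degree (pathColour (toℕ y)) (pth y) ≢ degree (pathColour (toℕ y)) (pth z)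
      prefix-edge 0 y≡0 _ = first-edge-irregular (s≤s z≤n) refl parity-0 parity-wrap y≡0 y→z
      prefix-edge 1 y≡1 _ = θ-edge-irregular y≡1 y→z
      prefix-edge (suc (suc _)) _ (s≤s (s≤s ()))

    irregular : IsLocIrrColouring colouring
    irregular = isLocIrr-byEdges
      (λ i → degree-cycleEdge-irregular i
               (cycle-irregular (toℕ i) (toℕ<n i) (hubPathPart _ i refl) (hubPathPart _ (nextᶠ i) (toℕ-nextᶠ i))))
      path-irregular

  -- l ≡ 0: the cycle edges m-2 and m-1 are Y-coloured and the others are paired.
  module Pathless (m-even : parity m ≡ 0ℙ) (l≡0 : l ≡ 0) where

    cycleColour : ℕ → Fin 4
    cycleColour x with suc (suc x) <? m
    ... | yes _ = X (pairParity x)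
    ... | no _  = Y 0ℙ

    open Coloured cycleColour (λ _ → 0F) public

    colour-low : ∀ {x} → suc (suc x) < m → cycleColour x ≡ X (pairParity x)
    colour-low {x} x+2<m with suc (suc x) <? m
    ... | yes _     = refl
    ... | no x+2≮m = ⊥-elim (x+2≮m x+2<m)

    colour-high : ∀ {x} → m ≤ suc (suc x) → cycleColour x ≡ Y 0ℙ
    colour-high {x} m≤x+2 with suc (suc x) <? m
    ... | yes x+2<m = ⊥-elim (<-irrefl refl (≤-trans x+2<m m≤x+2))
    ... | no _      = refl

    X≢Y₀ : ∀ p → X p ≢ Y 0ℙ
    X≢Y₀ 0ℙ ()
    X≢Y₀ 1ℙ ()

    3<m : 3 < m
    3<m = ≤∧≢⇒< m≥3 (λ 3≡m → ℙ.p≢p⁻¹ 0ℙ (trans (sym m-even) (sym (cong parity 3≡m))))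

    colour-0 : cycleColour 0 ≡ X 0ℙ
    colour-0 = colour-low (≤-trans (s≤s (s≤s (s≤s z≤n))) m≥3)

    colour-1 : cycleColour 1 ≡ X 0ℙ
    colour-1 = colour-low 3<m

    colour-wrap : cycleColour (prev 0) ≡ Y 0ℙ
    colour-wrap = colour-high (≤-trans (≤-reflexive (sym suc-pred-m)) (n≤1+n _))

    cycle-irregular : ∀ x → x < m → CycleEdgeIrregular x 0 0
    cycle-irregular x x<m with cyclePosition x<m
    ... | first = middle-end-irregular {0} prev≢ next≡
      where
      prev≢ : cycleColour (prev 0) ≢ cycleColour 0
      prev≢ e = X≢Y₀ 0ℙ (trans (sym colour-0) (trans (sym e) colour-wrap))
      next≡ : cycleColour (next 0) ≡ cycleColour 0
      next≡ = trans (cong cycleColour next-0) (trans colour-1 (sym colour-0))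
    ... | last {x′} x+2≡m = middle-start-irregular {suc x′} (trans colour-prev (sym colour-x)) next≢
      where
      colour-prev : cycleColour x′ ≡ Y 0ℙ
      colour-prev = colour-high (≤-reflexive (sym x+2≡m))
      colour-x : cycleColour (suc x′) ≡ Y 0ℙ
      colour-x = colour-high (≤-trans (≤-reflexive (sym x+2≡m)) (n≤1+n _))
      next≢ : cycleColour (next (suc x′)) ≢ cycleColour (suc x′)
      next≢ e = X≢Y₀ 0ℙ (trans (sym colour-0) (trans (sym (cong cycleColour (next-last x+2≡m))) (trans e colour-x)))
    ... | middle {x′} x+2<m with suc (suc (suc x′)) ℕ.≟ m
    ...   | yes x+3≡m = middle-end-irregular {suc x′} prev≢ next≡
      where
      colour-x : cycleColour (suc x′) ≡ Y 0ℙ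
      colour-x = colour-high (≤-reflexive (sym x+3≡m))
      prev≢ : cycleColour x′ ≢ cycleColour (suc x′)
      prev≢ e = X≢Y₀ (pairParity x′) (trans (sym (colour-low x+2<m)) (trans e colour-x))
      next≡ : cycleColour (next (suc x′)) ≡ cycleColour (suc x′)
      next≡ = trans (cong cycleColour (next-< x+2<m))
                    (trans (colour-high (≤-trans (≤-reflexive (sym x+3≡m)) (n≤1+n _))) (sym colour-x))
    ...   | no x+3≢m with suc (suc (suc (suc x′))) ℕ.≟ m
    ...     | yes x+4≡m = middle-start-irregular {suc x′} prev≡ next≢
      where
      colour-x : cycleColour (suc x′) ≡ X (pairParity (suc x′))
      colour-x = colour-low (≤∧≢⇒< x+2<m x+3≢m)
      prev≡ : cycleColour x′ ≡ cycleColour (suc x′)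
      prev≡ = trans (colour-low x+2<m) (trans (cong X (sym (pairParity-even {x′} (trans (cong parity x+4≡m) m-even)))) (sym colour-x))
      next≢ : cycleColour (next (suc x′)) ≢ cycleColour (suc x′)
      next≢ e = X≢Y₀ _ (trans (sym colour-x) (trans (sym e) colour-next))
        where
        colour-next : cycleColour (next (suc x′)) ≡ Y 0ℙ
        colour-next = trans (cong cycleColour (next-< x+2<m)) (colour-high (≤-reflexive (sym x+4≡m)))
    ...     | no x+4≢m = alternating-irregular {suc x′} (colour-low x+2<m) (colour-low x+3<m) next≡
      where
      x+3<m : suc (suc (suc x′)) < m
      x+3<m = ≤∧≢⇒< x+2<m x+3≢m
      next≡ : cycleColour (next (suc x′)) ≡ X (pairParity x′ ⁻¹)
      next≡ = trans (cong cycleColour (next-< x+2<m)) (trans (colour-low (≤∧≢⇒< x+3<m x+4≢m)) (cong X (pairParity-+2 x′)))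

    no-path-edge : ∀ {y z : Fin (suc l)} → ¬ PathNext y z
    no-path-edge {z = z} y→z = 1+n≰0 (subst (_≤ 0) (sym y→z) (subst (toℕ z ≤_) l≡0 (≤-pred (toℕ<n z))))
      where
      1+n≰0 : ∀ {k} → suc k ≤ 0 → ⊥
      1+n≰0 ()

    noPathPart : ∀ {k} j → pathPart k (cyc j) ≡ 0
    noPathPart {k} j =
      pathPart-zero λ y _ → trans (cong (pathDegree k) (y≡0 y)) (cong (_+ 0) (forwardDegree-≥ (≤-reflexive l≡0)))
      where
      y≡0 : ∀ (y : Fin (suc l)) → toℕ y ≡ 0
      y≡0 y = n<1⇒n≡0 (subst (λ k → toℕ y < suc k) l≡0 (toℕ<n y))

    irregular : IsLocIrrColouring colouring
    irregular = isLocIrr-byEdges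
      (λ i → degree-cycleEdge-irregular i
               (with-pathParts (noPathPart i) (noPathPart (nextᶠ i)) (cycle-irregular (toℕ i) (toℕ<n i))))
      (λ y→z → ⊥-elim (no-path-edge y→z))

  -- Bipartiteness

  module Bipartition (side : Fin n → Bool) (proper : ∀ u w → adj G u w ≡ true → side u ≢ side w) where

    flip : Parity → Bool → Bool
    flip 0ℙ b = b
    flip 1ℙ b = not b

    flip-⁻¹ : ∀ p b → flip (p ⁻¹) b ≡ not (flip p b)
    flip-⁻¹ 0ℙ b = refl
    flip-⁻¹ 1ℙ b = sym (not-involutive b)

    flip-injective : ∀ p q b → flip p b ≡ flip q b → p ≡ q
    flip-injective 0ℙ 0ℙ b _ = refl
    flip-injective 1ℙ 1ℙ b _ = refl
    flip-injective 0ℙ 1ℙ b e = ⊥-elim (not-¬ refl e)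
    flip-injective 1ℙ 0ℙ b e = ⊥-elim (not-¬ refl (sym e))

    alternate : ∀ {a b} → adj G a b ≡ true → ∀ p → side a ≡ flip p (side v) → side b ≡ flip (p ⁻¹) (side v)
    alternate ab p a≡ = trans (¬-not (λ e → proper _ _ ab (sym e))) (trans (cong not a≡) (sym (flip-⁻¹ p (side v))))

    side-cyc : ∀ x (x<m : x < m) → side (cyc (fromℕ< x<m)) ≡ flip (parity x) (side v)
    side-cyc zero    x<m   = cong side (cyc-v _ (toℕ-fromℕ< x<m))
    side-cyc (suc x) x+1<m =
      trans (alternate (cyc-sub _ _ (fromℕ< x<m , fromℕ< x+1<m , inj₁ x→x+1 , inj₁ (refl , refl))) (parity x) (side-cyc x x<m))
            (cong (λ p → flip p (side v)) (sym (parity-suc x)))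
      where
      x<m = <⇒≤ x+1<m
      x→x+1 = trans (cong suc (toℕ-fromℕ< x<m)) (sym (toℕ-fromℕ< x+1<m))

    side-pth : ∀ y (y≤l : y < suc l) → side (pth (fromℕ< y≤l)) ≡ flip (parity y) (side v)
    side-pth zero    y≤l   = cong side (trans (cong pth (toℕ-injective (toℕ-fromℕ< y≤l))) pth-v)
    side-pth (suc y) y+1≤l =
      trans (alternate (pth-sub _ _ (fromℕ< y≤l , fromℕ< y+1≤l , y→y+1 , inj₁ (refl , refl))) (parity y) (side-pth y y≤l))
            (cong (λ p → flip p (side v)) (sym (parity-suc y)))
      where
      y≤l = <⇒≤ y+1≤l
      y→y+1 = trans (cong suc (toℕ-fromℕ< y≤l)) (sym (toℕ-fromℕ< y+1≤l))

    side-cycᶠ : ∀ i → side (cyc i) ≡ flip (parity (toℕ i)) (side v)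
    side-cycᶠ i = trans (cong (λ j → side (cyc j)) (sym (fromℕ<-toℕ i (toℕ<n i)))) (side-cyc (toℕ i) (toℕ<n i))

    side-pthᶠ : ∀ y → side (pth y) ≡ flip (parity (toℕ y)) (side v)
    side-pthᶠ y = trans (cong (λ z → side (pth z)) (sym (fromℕ<-toℕ y (toℕ<n y)))) (side-pth (toℕ y) (toℕ<n y))

    pathOnCycle-parity : ∀ {y i} → pth y ≡ cyc i → parity (toℕ y) ≡ parity (toℕ i)
    pathOnCycle-parity {y} {i} y≡i =
      flip-injective _ _ (side v) (trans (sym (side-pthᶠ y)) (trans (cong side y≡i) (side-cycᶠ i)))

    m-even : parity m ≡ 0ℙ
    m-even = begin
      parity m                  ≡⟨ cong parity (sym suc-pred-m) ⟩
      parity (suc (pred m))     ≡⟨ parity-suc (pred m) ⟩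
      parity (pred m) ⁻¹        ≡⟨ flip-injective _ _ (side v) (sym v-side) ⟩
      0ℙ                        ∎
      where
      open ≡-Reasoning
      m-1<m : pred m < m
      m-1<m = ≤-reflexive suc-pred-m
      wrap-edge : CycNext m (fromℕ< m-1<m) (fromℕ< 0<m)
      wrap-edge = inj₂ (trans (cong suc (toℕ-fromℕ< m-1<m)) suc-pred-m , toℕ-fromℕ< 0<m)
      v-side : side v ≡ flip (parity (pred m) ⁻¹) (side v)
      v-side = trans (cong side (sym v-on-cycle))
                     (alternate (cyc-sub _ _ (_ , _ , wrap-edge , inj₁ (refl , refl))) (parity (pred m)) (side-cyc (pred m) m-1<m))

    pathless-colouring : l ≡ 0 → χ'irr≤ G 4
    pathless-colouring l≡0 = colouring , irregular
      where open Pathless m-even l≡0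

    paired-colouring : pairParity m ≡ 0ℙ → χ'irr≤ G 4
    paired-colouring m%4≡0 with parity l in l%2
    ... | 0ℙ = colouring , irregular
      where open PairedCycle m-even m%4≡0 0 z≤n l%2
    ... | 1ℙ = colouring , irregular
      where open PairedCycle m-even m%4≡0 1 ≤-refl l%2

    oddPath-colouring : pairParity m ≡ 1ℙ → parity l ≡ 1ℙ → χ'irr≤ G 4
    oddPath-colouring m%4≡2 l-odd = colouring , irregular
      where
      0<l : 0 < l
      0<l = ≤∧≢⇒< z≤n (λ 0≡l → ℙ.p≢p⁻¹ 0ℙ (trans (cong parity 0≡l) l-odd))
      open HubAtV m-even m%4≡2 1 ≤-refl (s≤s z≤n) 0<l l-odd (λ _ _ _ _ → s≤s (s≤s z≤n))

    evenPath-colouring : pairParity m ≡ 1ℙ → l ≢ 0 → parity l ≡ 0ℙ → χ'irr≤ G 4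
    evenPath-colouring m%4≡2 l≢0 l-even = by-position (cycleIndex-view (pth y₂))
      where
      l≥2 : 2 ≤ l
      l≥2 = even-nonzero⇒2≤ l≢0 l-even
      y₂ : Fin (suc l)
      y₂ = fromℕ< (s≤s l≥2)
      y₂≡2 : toℕ y₂ ≡ 2
      y₂≡2 = toℕ-fromℕ< (s≤s l≥2)
      m-1%4≡0 : pairParity (pred m) ≡ 0ℙ
      m-1%4≡0 = trans (pairParity-before-even {pred m} (trans (cong parity suc-pred-m) m-even))
                      (cong _⁻¹ (trans (cong pairParity suc-pred-m) m%4≡2))
      by-position : ∀ {mi} → CycleView (pth y₂) mi → χ'irr≤ G 4
      by-position (offCycle y₂∉C) = colouring , irregular
        where
        open HubAtV m-even m%4≡2 2 (s≤s z≤n) ≤-refl l≥2 l-even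
                    (λ y i y≡i y≡2 → ⊥-elim (y₂∉C i (trans (sym y≡i) (cong pth (toℕ-injective (trans y≡2 (sym y₂≡2)))))))
      by-position (onCycle θ θ≡y₂) = by-θ-class (pairParity (toℕ θ)) refl
        where
        θ-even : parity (toℕ θ) ≡ 0ℙ
        θ-even = trans (sym (pathOnCycle-parity (sym θ≡y₂))) (cong parity y₂≡2)
        by-θ-class : ∀ p → pairParity (toℕ θ) ≡ p → χ'irr≤ G 4
        by-θ-class 1ℙ θ%4≡2 = colouring , irregular
          where
          open HubsAtVAndθ m-even l≥2 l-even y₂ y₂≡2 θ θ≡y₂ θ-even (λ x → pairParity (suc x)) pairParity
                           (λ x → pairParity-+2 (suc x)) pairParity-+2 refl
                           (λ x+1≡θ → trans (cong pairParity x+1≡θ) θ%4≡2) θ%4≡2 m-1%4≡0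
        by-θ-class 0ℙ θ%4≡0 = colouring , irregular
          where
          open HubsAtVAndθ m-even l≥2 l-even y₂ y₂≡2 θ θ≡y₂ θ-even pairParity (λ x → pairParity (suc x) ⁻¹)
                           pairParity-+2 (λ x → cong _⁻¹ (pairParity-+2 (suc x))) refl
                           (λ {x} x+1≡θ → trans (pairParity-before-even {x} (trans (cong parity x+1≡θ) θ-even))
                                                (cong _⁻¹ (trans (cong pairParity x+1≡θ) θ%4≡0)))
                           (cong _⁻¹ (trans (pairParity-even {toℕ θ} θ-even) θ%4≡0))
                           (cong _⁻¹ (trans (cong pairParity suc-pred-m) m%4≡2))

    χ'irr≤4 : χ'irr≤ G 4
    χ'irr≤4 with l ℕ.≟ 0 | pairParity m in m%4 | parity l in l%2
    ... | yes l≡0 | _  | _  = pathless-colouring l≡0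
    ... | no _    | 0ℙ | _  = paired-colouring m%4
    ... | no _    | 1ℙ | 1ℙ = oddPath-colouring m%4 l%2
    ... | no l≢0  | 1ℙ | 0ℙ = evenPath-colouring m%4 l≢0 l%2

lemma10 : {n : ℕ} (G : Graph n) (v : Fin n) → Bipartite G → CyclePathDecomp G v → χ'irr≤ G 4
lemma10 G v (side , proper) D = χ'irr≤4
  where open CyclePath D; open Bipartition side proper
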